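{- Let $\mathcal{T}$ be a single-elimination tournament with $n$ players and let $U\subseteq V(\mathcal{T})$ be the set of vertices $u$ such that there is no $x\in N^+(u)$ with $N^-(x)=\{a,u\}$ for some player $a\in P(\mathcal{T})$. Then for every scoring system $\sigma$, \[\dim(\mathcal{T},\sigma)\le\min_{u\in U}\Big(n-|P(u)|+\max\Big\{0,\ \dim(\mathcal{T}_u,\sigma_u)-\sum_{x\in M(\mathcal{T})\setminus M(\mathcal{T}_u)}\Big\lfloor\frac{|N^-(x)\cap(P(\mathcal{T})\setminus P(u))|}{2}\Big\rfloor\Big\}\Big).\]
   Context: For a digraph, $N^+(v)$ is the set of out-neighbours of $v$ and $N^-(v)$ the set of in-neighbours; a sink has $N^+(v)=\emptyset$, a source has $N^-(v)=\emptyset$. A single-elimination tournament $\mathcal{T}$ is a finite digraph with: exactly one sink; $|N^+(v)|=1$ for every non-sink $v$; no directed cycles; and $|N^-(v)|\ne 1$ for every vertex $v$. Players $P(\mathcal{T})$ are the sources; matches $M(\mathcal{T})$ are the non-sources. A directed walk from $u_1$ to $u_t$ is a sequence $(u_1,\dots,u_t)$, $t\ge1$, with $u_{i+1}\in N^+(u_i)$; the player set $P(u)$ of a vertex $u$ is the set of players $a$ with a directed walk from $a$ to $u$. A bracket is a function $B:V(\mathcal{T})\to P(\mathcal{T})$ with $B(a)=a$ for every player $a$ and $B(x)\in\{B(v):v\in N^-(x)\}$ for every match $x$. A scoring system is a function $\sigma:M(\mathcal{T})\to\mathbb{R}_{>0}$; $\mathrm{score}_\sigma(B,B')=\sum_{x\in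 M(\mathcal{T}):B(x)=B'(x)}\sigma(x)$. A set of brackets $\mathcal{B}$ is $\sigma$-resolving if for all pairs of distinct brackets $B,B'$ there is $B_i\in\mathcal{B}$ with $\mathrm{score}_\sigma(B_i,B)\ne\mathrm{score}_\sigma(B_i,B')$; $\dim(\mathcal{T},\sigma)$ is the minimum size of a $\sigma$-resolving set. For $u\in V(\mathcal{T})$, $\mathcal{T}_u$ is the digraph obtained from $\mathcal{T}$ by deleting every vertex $v$ with $P(v)\not\subseteq P(u)$; it is a single-elimination tournament with sink $u$, in-neighbourhoods agreeing with those in $\mathcal{T}$, and match set $M(\mathcal{T}_u)=M(\mathcal{T})\cap V(\mathcal{T}_u)$; $\sigma_u$ is the restriction of $\sigma$ to $M(\mathcal{T}_u)$. -}

module Defs where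

open import Level using (0ℓ)
open import Data.Nat as ℕ using (ℕ; _∸_; _/_)
open import Data.Fin using (Fin)
open import Data.List using (List; []; _∷_; map; foldr; length)
open import Data.Nat.ListAction using (sum)
open import Data.List.Membership.Propositional using (_∈_)
open import Data.List.Relation.Unary.Unique.Propositional using (Unique)
open import Data.Product using (Σ; _×_; _,_; ∃)
open import Data.Sum using (_⊎_)
open import Data.Unit using (⊤)
open import Data.Empty using (⊥)
open import Relation.Nullary using (¬_)
open import Relation.Binary.PropositionalEquality using (_≡_; _≢_)
open import Algebra.Structures using (IsCommutativeRing)

-- An axiomatic model of the real numbers: a Dedekind-complete ordered
-- field (unique up to isomorphism).  The theorem is stated for every
-- such model.

record Reals : Set₁ where
  infixl 6 _+_
  infixl 7 _*_
  infix 4 _<_ _≤_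
  field
    ℝ    : Set
    0ℝ 1ℝ : ℝ
    _+_ _*_ : ℝ → ℝ → ℝ
    -_   : ℝ → ℝ
    _<_  : ℝ → ℝ → Set
    isCommutativeRing : IsCommutativeRing _≡_ _+_ _*_ -_ 0ℝ 1ℝ
    0≢1      : 0ℝ ≢ 1ℝ
    inverse  : ∀ x → x ≢ 0ℝ → Σ ℝ (λ y → x * y ≡ 1ℝ)
    <-irrefl : ∀ x → ¬ (x < x)
    <-trans  : ∀ {x y z} → x < y → y < z → x < z
    <-trich  : ∀ x y → x < y ⊎ (x ≡ y ⊎ y < x)
    +-mono-< : ∀ {x y} z → x < y → x + z < y + z
    *-pos    : ∀ {x y} → 0ℝ < x → 0ℝ < y → 0ℝ < x * y
  _≤_ : ℝ → ℝ → Set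
  x ≤ y = x < y ⊎ x ≡ y
  field
    complete : (P : ℝ → Set) → Σ ℝ P → Σ ℝ (λ b → ∀ x → P x → x ≤ b) →
               Σ ℝ (λ s → (∀ x → P x → x ≤ s) ×
                          (∀ b → (∀ x → P x → x ≤ b) → s ≤ b))

-- Finite sets of vertices (subsets of Fin m), cardinalities and sums,
-- given relationally via duplicate-free enumerations.

module _ {m : ℕ} where

  Enumerates : (Fin m → Set) → List (Fin m) → Set
  Enumerates P xs = Unique xs × (∀ x → (x ∈ xs → P x) × (P x → x ∈ xs))

  Card : (Fin m → Set) → ℕ → Set
  Card P k = Σ (List (Fin m)) λ xs → Enumerates P xs × length xs ≡ k

  SumℕIs : (Fin m → Set) → (Fin m → ℕ) → ℕ → Set
  SumℕIs P f s = Σ (List (Fin m)) λ xs → Enumerates P xs × s ≡ sum (map f xs)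

module _ (R : Reals) {m : ℕ} where
  open Reals R

  SumℝIs : (Fin m → Set) → (Fin m → ℝ) → ℝ → Set
  SumℝIs P f s = Σ (List (Fin m)) λ xs →
                   Enumerates P xs × s ≡ foldr _+_ 0ℝ (map f xs)

-- We also consider the
-- subdigraph induced on a vertex set V ⊆ Fin m (used for 𝒯_u); the
-- whole digraph is the case V = λ _ → ⊤.

module Digraph {m : ℕ} (V : Fin m → Set) (A : Fin m → Fin m → Set) where

  Arc : Fin m → Fin m → Set
  Arc v w = V v × V w × A v w

  Nout : Fin m → Fin m → Set
  Nout v w = Arc v w

  Nin : Fin m → Fin m → Set
  Nin v w = Arc w v

  IsSink : Fin m → Set
  IsSink v = V v × (∀ w → ¬ Nout v w)

  IsSource : Fin m → Set
  IsSource v = V v × (∀ w → ¬ Nin v w)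

  IsPlayer : Fin m → Set
  IsPlayer = IsSource

  IsMatch : Fin m → Set
  IsMatch v = V v × ¬ IsSource v

  data Walk : Fin m → Fin m → Set where
    here : ∀ {u} → V u → Walk u u
    step : ∀ {u v w} → Arc u v → Walk v w → Walk u w

  record IsSET : Set where
    field
      sink        : Fin m
      sink-isSink : IsSink sink
      sink-unique : ∀ v → IsSink v → v ≡ sink
      outdeg-one  : ∀ v → V v → ¬ IsSink v → Card (Nout v) 1
      acyclic     : ∀ {u v} → Arc u v → Walk v u → ⊥
      indeg-not-1 : ∀ v → V v → ¬ Card (Nin v) 1

  PlayersOf : Fin m → Fin m → Set
  PlayersOf u a = IsPlayer a × Walk a u

  -- brackets, represented as functions on Fin m whose values off V are
  -- irrelevant
  record IsBracket (B : Fin m → Fin m) : Set where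
    field
      into-players : ∀ v → V v → IsPlayer (B v)
      on-players   : ∀ a → IsPlayer a → B a ≡ a
      on-matches   : ∀ x → IsMatch x → Σ (Fin m) λ v → Nin x v × B x ≡ B v

  Distinct : (Fin m → Fin m) → (Fin m → Fin m) → Set
  Distinct B B′ = Σ (Fin m) λ v → V v × B v ≢ B′ v

  module _ (R : Reals) where
    open Reals R

    IsScoring : (Fin m → ℝ) → Set
    IsScoring σ = ∀ x → IsMatch x → 0ℝ < σ x

    ScoreIs : (Fin m → ℝ) → (Fin m → Fin m) → (Fin m → Fin m) → ℝ → Set
    ScoreIs σ B B′ s = SumℝIs R (λ x → IsMatch x × B x ≡ B′ x) σ s

    IsResolving : (Fin m → ℝ) → (k : ℕ) → (Fin k → Fin m → Fin m) → Set
    IsResolving σ k Bs =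
      (∀ i → IsBracket (Bs i)) ×
      (∀ B B′ → IsBracket B → IsBracket B′ → Distinct B B′ →
        Σ (Fin k) λ i → Σ ℝ λ s → Σ ℝ λ s′ →
          ScoreIs σ (Bs i) B s × ScoreIs σ (Bs i) B′ s′ × s ≢ s′)

    HasResolvingOfSize : (Fin m → ℝ) → ℕ → Set
    HasResolvingOfSize σ k = Σ (Fin k → Fin m → Fin m) (IsResolving σ k)

    DimIs : (Fin m → ℝ) → ℕ → Set
    DimIs σ d = HasResolvingOfSize σ d × (∀ k → HasResolvingOfSize σ k → d ℕ.≤ k)

module Tournament {m : ℕ} (A : Fin m → Fin m → Set) where

  open Digraph {m} (λ _ → ⊤) A public

  Vsub : Fin m → Fin m → Set
  Vsub u v = ∀ a → PlayersOf v a → PlayersOf u a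

  module Sub (u : Fin m) = Digraph {m} (Vsub u) A

  InU : Fin m → Set
  InU u = ¬ (Σ (Fin m) λ x → Nout u x × Σ (Fin m) λ a → IsPlayer a ×
              (∀ w → (Nin x w → (w ≡ a ⊎ w ≡ u)) × ((w ≡ a ⊎ w ≡ u) → Nin x w)))

  MatchOutside : Fin m → Fin m → Set
  MatchOutside u x = IsMatch x × ¬ Sub.IsMatch u x

  InNbrOutside : Fin m → Fin m → Fin m → Set
  InNbrOutside u x w = Nin x w × IsPlayer w × ¬ PlayersOf u w

module Submission where

open import Defs
open import Level using (0ℓ)
open import Algebra.Bundles using (CommutativeMonoid)
open import Algebra.Core using (Op₂)
open import Algebra.Structures using (IsCommutativeMonoid; IsCommutativeRing)
open import Data.Nat as ℕ using (ℕ; zero; suc; z≤n; s≤s; _∸_; _/_)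
import Data.Nat.Properties as ℕ
import Data.Nat.ListAction as ℕ
open import Data.Nat.DivMod using (m/n≡1+[m∸n]/n)
open import Data.Nat.GeneralisedArithmetic using (fold; iterate)
open import Data.Nat.Induction using (<-wellFounded)
open import Data.Fin as Fin using (Fin; toℕ; fromℕ<)
import Data.Fin.Properties as Fin
open import Data.Fin.Properties using (_≟_)
open import Data.List using (List; []; _∷_; length; map; foldr; _++_; filter; allFin; applyUpTo)
import Data.List.Properties as List
open import Data.List.Membership.Propositional using (_∈_; find)
import Data.List.Membership.Propositional.Properties as ∈
open import Data.List.Relation.Unary.Any using (here; there)
open import Data.List.Relation.Unary.Any.Properties using (¬Any[])
import Data.List.Relation.Unary.All as All
open import Data.List.Relation.Unary.All using (All; []; _∷_)
open import Data.List.Relation.Unary.All.Properties using (¬All⇒Any¬)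
open import Data.List.Relation.Unary.AllPairs using ([]; _∷_)
open import Data.List.Relation.Unary.Unique.Propositional using (Unique)
import Data.List.Relation.Unary.Unique.Propositional.Properties as Unique
open import Data.Product using (Σ; _×_; _,_; proj₁; proj₂)
open import Data.Sum using (_⊎_; inj₁; inj₂)
open import Data.Unit using (⊤; tt)
open import Data.Empty using (⊥; ⊥-elim)
open import Function using (_∘_; _∘′_; id; flip)
open import Induction.WellFounded using (WellFounded)
import Induction.WellFounded as WF
import Relation.Binary.Construct.On as On
open import Relation.Nullary using (¬_; Dec; yes; no)
open import Relation.Nullary.Decidable using (_×-dec_; _⊎-dec_; ¬?)
open import Relation.Unary using (Pred; Decidable)
open import Relation.Binary.PropositionalEquality

-- Fix a σᵤ-resolving set R₀ … R_{du-1} of 𝒯ᵤ. All brackets used are glued: some inner bracket on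
-- 𝒯ᵤ, and outside 𝒯ᵤ the bracket in which one outer player a wins every match on its path while all
-- other matches follow a default bracket whose outside matches are won by outer players. The score
-- against a glued bracket splits into an inner and an outer part. For glued X, Y with the same inner
-- part, equal scores on B and B′ give score X B + score Y B′ = score X B′ + score Y B, so no match may
-- count more on one side; choosing the favoured players at a lowest or highest outside disagreement
-- of B and B′ produces such a match. So B and B′ agree outside 𝒯ᵤ up to winners in P(u), the outer
-- parts of their scores coincide, and the Rᵢ separate them inside 𝒯ᵤ.
-- Every outer player gets one glued bracket. The two players of a duel (two outer players entering
-- the same outside match) may share one Rᵢ, because each then wins the same matches in B and B′; the
-- S duels carry S of the Rᵢ and the other du ∸ S are added separately. Unpaired players share the
-- inner bracket of an anchor duel below the parent of u, which exists because u ∈ U.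

card-1⇒unique : ∀ {m} {P : Pred (Fin m) 0ℓ} → Card P 1 →
                Σ (Fin m) λ z → P z × (∀ x → P x → x ≡ z)
card-1⇒unique (z ∷ [] , (_ , mem) , refl) =
  z , proj₁ (mem z) (here refl) , λ x px → singleton (proj₂ (mem x) px)
  where
  singleton : ∀ {x} → x ∈ z ∷ [] → x ≡ z
  singleton (here x≡z) = x≡z

𝟙 : ∀ {Q : Set} → Dec Q → ℕ
𝟙 (yes _) = 1
𝟙 (no _)  = 0

𝟙-yes : ∀ {Q : Set} (d : Dec Q) → Q → 𝟙 d ≡ 1
𝟙-yes (yes _) _ = refl
𝟙-yes (no ¬q) q = ⊥-elim (¬q q)

𝟙-no : ∀ {Q : Set} (d : Dec Q) → ¬ Q → 𝟙 d ≡ 0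
𝟙-no (yes q) ¬q = ⊥-elim (¬q q)
𝟙-no (no _)  _  = refl

𝟙-mono : ∀ {Q Q′ : Set} (d : Dec Q) (d′ : Dec Q′) → (Q → Q′) → 𝟙 d ℕ.≤ 𝟙 d′
𝟙-mono (yes q) (yes _)  f = ℕ.≤-refl
𝟙-mono (yes q) (no ¬q′) f = ⊥-elim (¬q′ (f q))
𝟙-mono (no _)  _        f = z≤n

𝟙-cong : ∀ {Q Q′ : Set} (d : Dec Q) (d′ : Dec Q′) → (Q → Q′) → (Q′ → Q) → 𝟙 d ≡ 𝟙 d′
𝟙-cong d d′ f g = ℕ.≤-antisym (𝟙-mono d d′ f) (𝟙-mono d′ d g)

𝟙≤1 : ∀ {Q : Set} (d : Dec Q) → 𝟙 d ℕ.≤ 1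
𝟙≤1 (yes _) = ℕ.≤-refl
𝟙≤1 (no _)  = z≤n

enumeration : ∀ {m} {P : Pred (Fin m) 0ℓ} → Decidable P → Σ (List (Fin m)) (Enumerates P)
enumeration {m} P? = filter P? (allFin m) ,
                     Unique.filter⁺ P? (Unique.allFin⁺ m) ,
                     λ x → proj₂ ∘ ∈.∈-filter⁻ P? {xs = allFin m} , ∈.∈-filter⁺ P? (∈.∈-allFin x)

module IndicatorSum {C : Set} {_∙_ : Op₂ C} {ε : C}
                    (isCM : IsCommutativeMonoid _≡_ _∙_ ε) where

  monoid : CommutativeMonoid 0ℓ 0ℓ
  monoid = record { isCommutativeMonoid = isCM }

  open IsCommutativeMonoid isCM using (identityˡ; identityʳ)
  open import Algebra.Properties.CommutativeMonoid.Sum monoid public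
    using (sum; sum-cong-≗; ∑-distrib-+; sum-replicate-zero)
  open import Algebra.Properties.Monoid.Mult (CommutativeMonoid.monoid monoid) public
    using (×-homo-+) renaming (_×_ to _·_)

  ∑-δ : ∀ {m} (g : Fin m → C) y → (∀ x → x ≢ y → g x ≡ ε) → sum g ≡ g y
  ∑-δ {suc m} g Fin.zero vanish = begin
    g Fin.zero ∙ sum (g ∘ Fin.suc)    ≡⟨ cong (g Fin.zero ∙_) (sum-cong-≗ (λ x → vanish (Fin.suc x) λ ())) ⟩
    g Fin.zero ∙ sum {m} (λ _ → ε)    ≡⟨ cong (g Fin.zero ∙_) (sum-replicate-zero m) ⟩
    g Fin.zero ∙ ε                    ≡⟨ identityʳ _ ⟩
    g Fin.zero                        ∎
    where open ≡-Reasoning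
  ∑-δ {suc m} g (Fin.suc y) vanish = begin
    g Fin.zero ∙ sum (g ∘ Fin.suc)    ≡⟨ cong (_∙ sum (g ∘ Fin.suc)) (vanish Fin.zero λ ()) ⟩
    ε ∙ sum (g ∘ Fin.suc)             ≡⟨ identityˡ _ ⟩
    sum (g ∘ Fin.suc)                 ≡⟨ ∑-δ (g ∘ Fin.suc) y (λ x x≢y → vanish (Fin.suc x) (x≢y ∘ Fin.suc-injective)) ⟩
    g (Fin.suc y)                     ∎
    where open ≡-Reasoning

  ∑[_] : ∀ {m} {P : Pred (Fin m) 0ℓ} → Decidable P → (Fin m → C) → C
  ∑[ P? ] f = sum (λ x → 𝟙 (P? x) · f x)

  foldr≡∑ : ∀ {m} {P : Pred (Fin m) 0ℓ} (P? : Decidable P) (f : Fin m → C) {xs} →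
            Enumerates P xs → foldr _∙_ ε (map f xs) ≡ ∑[ P? ] f
  foldr≡∑ {m} P? f {[]} (_ , mem) = sym (trans (sum-cong-≗ absent) (sum-replicate-zero m))
    where
    absent : ∀ x → 𝟙 (P? x) · f x ≡ ε
    absent x rewrite 𝟙-no (P? x) (¬Any[] ∘ proj₂ (mem x)) = refl
  foldr≡∑ {m} {P} P? f {y ∷ ys} (y∉ys ∷ uys , mem) = begin
    f y ∙ foldr _∙_ ε (map f ys)
      ≡⟨ cong₂ _∙_ (sym (trans (∑-δ _ y at-y) hit)) (foldr≡∑ P′? f (uys , mem′)) ⟩
    sum (λ x → 𝟙 (x Fin.≟ y) · f x) ∙ ∑[ P′? ] f
      ≡⟨ sym (∑-distrib-+ (λ x → 𝟙 (x Fin.≟ y) · f x) (λ x → 𝟙 (P′? x) · f x)) ⟩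
    sum (λ x → (𝟙 (x Fin.≟ y) · f x) ∙ (𝟙 (P′? x) · f x))
      ≡⟨ sum-cong-≗ (λ x → sym (trans (cong (_· f x) (split x)) (×-homo-+ (f x) (𝟙 (x Fin.≟ y)) (𝟙 (P′? x))))) ⟩
    ∑[ P? ] f
      ∎
    where
    open ≡-Reasoning
    P′ : Pred (Fin m) 0ℓ
    P′ x = P x × x ≢ y
    P′? : Decidable P′
    P′? x = P? x ×-dec ¬? (x Fin.≟ y)
    at-y : ∀ x → x ≢ y → 𝟙 (x Fin.≟ y) · f x ≡ ε
    at-y x x≢y rewrite 𝟙-no (x Fin.≟ y) x≢y = refl
    hit : 𝟙 (y Fin.≟ y) · f y ≡ f y
    hit rewrite 𝟙-yes (y Fin.≟ y) refl = identityʳ (f y)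
    mem′ : ∀ x → (x ∈ ys → P′ x) × (P′ x → x ∈ ys)
    mem′ x = (λ x∈ys → proj₁ (mem x) (there x∈ys) , λ { refl → All.lookup y∉ys x∈ys refl })
           , λ { (px , x≢y) → tail x≢y (proj₂ (mem x) px) }
      where tail : x ≢ y → x ∈ y ∷ ys → x ∈ ys
            tail x≢y (here x≡y) = ⊥-elim (x≢y x≡y)
            tail x≢y (there x∈ys) = x∈ys
    split : ∀ x → 𝟙 (P? x) ≡ 𝟙 (x Fin.≟ y) ℕ.+ 𝟙 (P′? x)
    split x with P? x | x Fin.≟ y
    ... | yes _  | yes refl = refl
    ... | yes _  | no _     = refl
    ... | no ¬px | yes refl = ⊥-elim (¬px (proj₁ (mem y) (here refl)))
    ... | no _   | no _     = refl

module Counting {m : ℕ} where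
  open IndicatorSum ℕ.+-0-isCommutativeMonoid

  count : {P : Pred (Fin m) 0ℓ} → Decidable P → ℕ
  count P? = sum (𝟙 ∘ P?)

  ∑-mono-≤ : ∀ {k} {f g : Fin k → ℕ} → (∀ x → f x ℕ.≤ g x) → sum f ℕ.≤ sum g
  ∑-mono-≤ {zero}  f≤g = z≤n
  ∑-mono-≤ {suc k} f≤g = ℕ.+-mono-≤ (f≤g Fin.zero) (∑-mono-≤ (f≤g ∘ Fin.suc))

  card≡count : ∀ {P : Pred (Fin m) 0ℓ} (P? : Decidable P) {k} → Card P k → k ≡ count P?
  card≡count P? (xs , enum , refl) = begin
    length xs                    ≡⟨ length≡foldr xs ⟩
    foldr ℕ._+_ 0 (map (λ _ → 1) xs) ≡⟨ foldr≡∑ P? (λ _ → 1) enum ⟩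
    ∑[ P? ] (λ _ → 1)            ≡⟨ sum-cong-≗ (𝟙·1 ∘ P?) ⟩
    count P?                     ∎
    where
    open ≡-Reasoning
    𝟙·1 : ∀ {Q : Set} (d : Dec Q) → 𝟙 d · 1 ≡ 𝟙 d
    𝟙·1 (yes _) = refl
    𝟙·1 (no _)  = refl
    length≡foldr : ∀ (ys : List (Fin m)) → length ys ≡ foldr ℕ._+_ 0 (map (λ _ → 1) ys)
    length≡foldr []       = refl
    length≡foldr (_ ∷ ys) = cong suc (length≡foldr ys)

  count-mono : ∀ {P Q : Pred (Fin m) 0ℓ} (P? : Decidable P) (Q? : Decidable Q) →
               (∀ {x} → P x → Q x) → count P? ℕ.≤ count Q?
  count-mono P? Q? P⇒Q = ∑-mono-≤ (λ x → 𝟙-mono (P? x) (Q? x) P⇒Q)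

  length≤count : ∀ {P : Pred (Fin m) 0ℓ} (P? : Decidable P) {xs} → Unique xs →
                 (∀ {x} → x ∈ xs → P x) → length xs ℕ.≤ count P?
  length≤count P? {xs} uxs xs⊆P = begin
    length xs ≡⟨ card≡count (_∈? xs) (xs , (uxs , λ x → id , id) , refl) ⟩
    count (_∈? xs) ≤⟨ count-mono (_∈? xs) P? xs⊆P ⟩
    count P? ∎
    where
    open ℕ.≤-Reasoning
    open import Data.List.Membership.DecPropositional (Fin._≟_ {m}) using (_∈?_)

  count-split : ∀ {P Q : Pred (Fin m) 0ℓ} (P? : Decidable P) (Q? : Decidable Q) →
                count P? ≡ count (λ x → P? x ×-dec Q? x) ℕ.+ count (λ x → P? x ×-dec ¬? (Q? x))
  count-split P? Q? = trans (sum-cong-≗ split) (∑-distrib-+ (λ x → 𝟙 (P? x ×-dec Q? x)) (λ x → 𝟙 (P? x ×-dec ¬? (Q? x))))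
    where
    split : ∀ x → 𝟙 (P? x) ≡ 𝟙 (P? x ×-dec Q? x) ℕ.+ 𝟙 (P? x ×-dec ¬? (Q? x))
    split x with P? x | Q? x
    ... | yes _ | yes _ = refl
    ... | yes _ | no _  = refl
    ... | no _  | _     = refl

module RealOrder (R : Reals) where
  open Reals R
  open IsCommutativeRing isCommutativeRing
    using (+-assoc; +-comm; +-identityˡ; +-identityʳ; -‿inverseʳ; +-isCommutativeMonoid)
  open IndicatorSum +-isCommutativeMonoid public using (sum; _·_)

  <⇒≢ : ∀ {x y} → x < y → x ≢ y
  <⇒≢ {x} x<x refl = <-irrefl x x<x

  _≟ℝ_ : ∀ x y → Dec (x ≡ y)
  x ≟ℝ y with <-trich x y
  ... | inj₁ x<y         = no (<⇒≢ x<y)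
  ... | inj₂ (inj₁ x≡y)  = yes x≡y
  ... | inj₂ (inj₂ y<x)  = no (<⇒≢ y<x ∘ sym)

  ≤-refl : ∀ {x} → x ≤ x
  ≤-refl = inj₂ refl

  <-≤-trans : ∀ {x y z} → x < y → y ≤ z → x < z
  <-≤-trans x<y (inj₁ y<z) = <-trans x<y y<z
  <-≤-trans x<y (inj₂ refl) = x<y

  ≤-trans : ∀ {x y z} → x ≤ y → y ≤ z → x ≤ z
  ≤-trans (inj₁ x<y)  y≤z = inj₁ (<-≤-trans x<y y≤z)
  ≤-trans (inj₂ refl) y≤z = y≤z

  +-monoʳ-< : ∀ {x y} z → x < y → z + x < z + y
  +-monoʳ-< {x} {y} z x<y = subst₂ _<_ (+-comm x z) (+-comm y z) (+-mono-< z x<y)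

  +-monoˡ-≤ : ∀ {x y} z → x ≤ y → x + z ≤ y + z
  +-monoˡ-≤ z (inj₁ x<y)  = inj₁ (+-mono-< z x<y)
  +-monoˡ-≤ z (inj₂ refl) = ≤-refl

  +-monoʳ-≤ : ∀ {x y} z → x ≤ y → z + x ≤ z + y
  +-monoʳ-≤ z (inj₁ x<y)  = inj₁ (+-monoʳ-< z x<y)
  +-monoʳ-≤ z (inj₂ refl) = ≤-refl

  +-mono-≤ : ∀ {a b c d} → a ≤ b → c ≤ d → a + c ≤ b + d
  +-mono-≤ {b = b} {c = c} a≤b c≤d = ≤-trans (+-monoˡ-≤ c a≤b) (+-monoʳ-≤ b c≤d)

  +-mono-<-≤ : ∀ {a b c d} → a < b → c ≤ d → a + c < b + d
  +-mono-<-≤ {b = b} {c = c} a<b c≤d = <-≤-trans (+-mono-< c a<b) (+-monoʳ-≤ b c≤d)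

  +-mono-≤-< : ∀ {a b c d} → a ≤ b → c < d → a + c < b + d
  +-mono-≤-< {b = b} {c = c} (inj₁ a<b) c<d = <-trans (+-mono-< c a<b) (+-monoʳ-< b c<d)
  +-mono-≤-< (inj₂ refl) c<d = +-monoʳ-< _ c<d

  +-cancelʳ : ∀ {a b} c → a + c ≡ b + c → a ≡ b
  +-cancelʳ {a} {b} c eq = begin
    a                ≡⟨ sym (+-identityʳ a) ⟩
    a + 0ℝ           ≡⟨ cong (a +_) (sym (-‿inverseʳ c)) ⟩
    a + (c + - c)    ≡⟨ sym (+-assoc a c (- c)) ⟩
    (a + c) + - c    ≡⟨ cong (_+ - c) eq ⟩
    (b + c) + - c    ≡⟨ +-assoc b c (- c) ⟩
    b + (c + - c)    ≡⟨ cong (b +_) (-‿inverseʳ c) ⟩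
    b + 0ℝ           ≡⟨ +-identityʳ b ⟩
    b                ∎
    where open ≡-Reasoning

  ·-nonneg : ∀ {w} k → 0ℝ < w → 0ℝ ≤ k · w
  ·-nonneg zero    0<w = ≤-refl
  ·-nonneg {w} (suc k) 0<w = subst (_≤ w + k · w) (+-identityˡ 0ℝ) (+-mono-≤ (inj₁ 0<w) (·-nonneg k 0<w))

  ·-monoˡ-≤ : ∀ {w k k′} → 0ℝ < w → k ℕ.≤ k′ → k · w ≤ k′ · w
  ·-monoˡ-≤ {k′ = k′} 0<w z≤n = ·-nonneg k′ 0<w
  ·-monoˡ-≤ {w}       0<w (s≤s k≤k′) = +-monoʳ-≤ w (·-monoˡ-≤ 0<w k≤k′)

  ·-monoˡ-< : ∀ {w k k′} → 0ℝ < w → k ℕ.< k′ → k · w < k′ · w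
  ·-monoˡ-< {w} {k} 0<w (s≤s k≤k′) =
    subst (_< _) (+-identityˡ (k · w)) (+-mono-<-≤ 0<w (·-monoˡ-≤ 0<w k≤k′))

  ∑-mono-≤ : ∀ {k} {f g : Fin k → ℝ} → (∀ x → f x ≤ g x) → sum f ≤ sum g
  ∑-mono-≤ {zero}  f≤g = ≤-refl
  ∑-mono-≤ {suc k} f≤g = +-mono-≤ (f≤g Fin.zero) (∑-mono-≤ (f≤g ∘ Fin.suc))

  ∑-mono-< : ∀ {k} {f g : Fin k → ℝ} → (∀ x → f x ≤ g x) → ∀ x₀ → f x₀ < g x₀ → sum f < sum g
  ∑-mono-< f≤g Fin.zero     f<g = +-mono-<-≤ f<g (∑-mono-≤ (f≤g ∘ Fin.suc))
  ∑-mono-< f≤g (Fin.suc x₀) f<g = +-mono-≤-< (f≤g Fin.zero) (∑-mono-< (f≤g ∘ Fin.suc) x₀ f<g)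

module Pairing {A T : Set} where

  pairUp : T → List A → List (A × A × T)
  pairUp x (a ∷ b ∷ l) = (a , b , x) ∷ pairUp x l
  pairUp x _           = []

  members : List (A × A × T) → List A
  members []                  = []
  members ((a , b , _) ∷ ps) = a ∷ b ∷ members ps

  length-pairUp : ∀ x l → length (pairUp x l) ≡ length l / 2
  length-pairUp x []          = refl
  length-pairUp x (a ∷ [])    = refl
  length-pairUp x (a ∷ b ∷ l) = trans (cong suc (length-pairUp x l)) (sym (m/n≡1+[m∸n]/n {suc (suc (length l))} {2} (s≤s (s≤s z≤n))))

  ∈-pairUp⁻ : ∀ {x l a b x′} → Unique l → (a , b , x′) ∈ pairUp x l → a ∈ l × b ∈ l × x′ ≡ x × a ≢ b
  ∈-pairUp⁻ {x} {a ∷ b ∷ l} ((a≢b ∷ _) ∷ _)  (here refl) = here refl , there (here refl) , refl , a≢b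
  ∈-pairUp⁻ {x} {a ∷ b ∷ l} (_ ∷ _ ∷ unique) (there p) with ∈-pairUp⁻ unique p
  ... | a′∈l , b′∈l , x′≡x , a′≢b′ = there (there a′∈l) , there (there b′∈l) , x′≡x , a′≢b′

  pairUp-nonempty : ∀ x l → 2 ℕ.≤ length l → Σ A λ a → Σ A λ b → (a , b , x) ∈ pairUp x l
  pairUp-nonempty x (a ∷ b ∷ l) _             = a , b , here refl
  pairUp-nonempty x (a ∷ [])    (s≤s ())

  members-pairUp⊆ : ∀ {x l z} → z ∈ members (pairUp x l) → z ∈ l
  members-pairUp⊆ {x} {a ∷ b ∷ l} (here z≡a)         = here z≡a
  members-pairUp⊆ {x} {a ∷ b ∷ l} (there (here z≡b)) = there (here z≡b)
  members-pairUp⊆ {x} {a ∷ b ∷ l} (there (there p))  = there (there (members-pairUp⊆ p))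

  private
    all-⊆ : ∀ {P : A → Set} {l l′ : List A} → All P l → (∀ {z} → z ∈ l′ → z ∈ l) → All P l′
    all-⊆ {l′ = []}     all sub = []
    all-⊆ {l′ = z ∷ l′} all sub = All.lookup all (sub (here refl)) ∷ all-⊆ all (sub ∘′ there)

  unique-members-pairUp : ∀ x l → Unique l → Unique (members (pairUp x l))
  unique-members-pairUp x []          _ = []
  unique-members-pairUp x (a ∷ [])    _ = []
  unique-members-pairUp x (a ∷ b ∷ l) ((a≢b ∷ a∉l) ∷ b∉l ∷ unique) =
    (a≢b ∷ all-⊆ a∉l members-pairUp⊆) ∷ all-⊆ b∉l members-pairUp⊆ ∷ unique-members-pairUp x l unique

  members-++ : ∀ ps qs → members (ps ++ qs) ≡ members ps ++ members qs
  members-++ []                 qs = refl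
  members-++ ((a , b , _) ∷ ps) qs = cong (λ t → a ∷ b ∷ t) (members-++ ps qs)

  ∈-members⁻ : ∀ {z} ps → z ∈ members ps → Σ (A × A × T) λ t → t ∈ ps × (z ≡ proj₁ t ⊎ z ≡ proj₁ (proj₂ t))
  ∈-members⁻ ((a , b , x) ∷ ps) (here z≡a)         = (a , b , x) , here refl , inj₁ z≡a
  ∈-members⁻ ((a , b , x) ∷ ps) (there (here z≡b)) = (a , b , x) , here refl , inj₂ z≡b
  ∈-members⁻ ((a , b , x) ∷ ps) (there (there p)) with ∈-members⁻ ps p
  ... | t , t∈ps , z∈t = t , there t∈ps , z∈t

  ∈-members⁺ : ∀ {a b x} ps → (a , b , x) ∈ ps → a ∈ members ps
  ∈-members⁺ (_ ∷ ps)           (here refl) = here refl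
  ∈-members⁺ ((_ , _ , _) ∷ ps) (there p)   = there (there (∈-members⁺ ps p))

  module _ (L : T → List A) where

    pairsOf : List T → List (A × A × T)
    pairsOf []       = []
    pairsOf (x ∷ xs) = pairUp x (L x) ++ pairsOf xs

    length-pairsOf : ∀ xs → length (pairsOf xs) ≡ ℕ.sum (map (λ x → length (L x) / 2) xs)
    length-pairsOf []       = refl
    length-pairsOf (x ∷ xs) = trans (List.length-++ (pairUp x (L x))) (cong₂ ℕ._+_ (length-pairUp x (L x)) (length-pairsOf xs))

    ∈-pairsOf⁻ : ∀ {t} xs → t ∈ pairsOf xs → Σ T λ x → x ∈ xs × t ∈ pairUp x (L x)
    ∈-pairsOf⁻ (x ∷ xs) p with ∈.∈-++⁻ (pairUp x (L x)) p
    ... | inj₁ q = x , here refl , q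
    ... | inj₂ q with ∈-pairsOf⁻ xs q
    ...   | x′ , x′∈xs , r = x′ , there x′∈xs , r

    ∈-pairsOf⁺ : ∀ {t x} xs → x ∈ xs → t ∈ pairUp x (L x) → t ∈ pairsOf xs
    ∈-pairsOf⁺ (x ∷ xs) (here refl) q = ∈.∈-++⁺ˡ q
    ∈-pairsOf⁺ (y ∷ xs) (there x∈xs) q = ∈.∈-++⁺ʳ (pairUp y (L y)) (∈-pairsOf⁺ xs x∈xs q)

    members-pairsOf⊆ : ∀ {z} xs → z ∈ members (pairsOf xs) → Σ T λ x → x ∈ xs × z ∈ L x
    members-pairsOf⊆ (x ∷ xs) p rewrite members-++ (pairUp x (L x)) (pairsOf xs)
      with ∈.∈-++⁻ (members (pairUp x (L x))) p
    ... | inj₁ q = x , here refl , members-pairUp⊆ q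
    ... | inj₂ q with members-pairsOf⊆ xs q
    ...   | x′ , x′∈xs , r = x′ , there x′∈xs , r

    unique-members-pairsOf : ∀ xs → Unique xs → (∀ x → Unique (L x)) →
      (∀ {x x′ z} → z ∈ L x → z ∈ L x′ → x ≡ x′) → Unique (members (pairsOf xs))
    unique-members-pairsOf []       _               _      _        = []
    unique-members-pairsOf (x ∷ xs) (x∉xs ∷ unique) unique-L disjoint
      rewrite members-++ (pairUp x (L x)) (pairsOf xs) =
      Unique.++⁺ (unique-members-pairUp x (L x) (unique-L x)) (unique-members-pairsOf xs unique unique-L disjoint) apart
      where
      apart : ∀ {z} → z ∈ members (pairUp x (L x)) × z ∈ members (pairsOf xs) → ⊥
      apart (p , q) with members-pairsOf⊆ xs q
      ... | x′ , x′∈xs , z∈Lx′ = All.lookup x∉xs x′∈xs (disjoint (members-pairUp⊆ p) z∈Lx′)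

module InTree {m : ℕ} (A : Fin m → Fin m → Set) (isSET : Tournament.IsSET A) where
  open Tournament A
  open IsSET isSET

  sink-has-no-arc : ∀ {w} → ¬ Arc sink w
  sink-has-no-arc {w} = proj₂ sink-isSink w

  private
    out-arc : ∀ v → v ≢ sink → Σ (Fin m) λ w → Arc v w × (∀ x → Arc v x → x ≡ w)
    out-arc v v≢sink = card-1⇒unique (outdeg-one v tt (v≢sink ∘ sink-unique v))

  parent : Fin m → Fin m
  parent v with v ≟ sink
  ... | yes _      = v
  ... | no v≢sink  = proj₁ (out-arc v v≢sink)

  parent-arc : ∀ {v} → v ≢ sink → Arc v (parent v)
  parent-arc {v} v≢sink with v ≟ sink
  ... | yes v≡sink = ⊥-elim (v≢sink v≡sink)
  ... | no v≢sink′ = proj₁ (proj₂ (out-arc v v≢sink′))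

  arc⇒parent : ∀ {v w} → Arc v w → parent v ≡ w
  arc⇒parent {v} {w} a with v ≟ sink
  ... | yes refl     = ⊥-elim (sink-has-no-arc a)
  ... | no v≢sink    = sym (proj₂ (proj₂ (out-arc v v≢sink)) w a)

  arc-unique : ∀ {v w w′} → Arc v w → Arc v w′ → w ≡ w′
  arc-unique a b = trans (sym (arc⇒parent a)) (arc⇒parent b)

  walk-refl : ∀ {x} → Walk x x
  walk-refl = here tt

  infixr 5 _◅◅_
  _◅◅_ : ∀ {x y z} → Walk x y → Walk y z → Walk x z
  here _   ◅◅ q = q
  step a p ◅◅ q = step a (p ◅◅ q)

  arc⇒walk : ∀ {x y} → Arc x y → Walk x y
  arc⇒walk a = step a walk-refl

  walk-parent : ∀ v → Walk v (parent v)
  walk-parent v with v ≟ sink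
  ... | yes _     = walk-refl
  ... | no v≢sink = arc⇒walk (proj₁ (proj₂ (out-arc v v≢sink)))

  walk-antisym : ∀ {x y} → Walk x y → Walk y x → x ≡ y
  walk-antisym (here _)   q = refl
  walk-antisym (step a p) q = ⊥-elim (acyclic a (p ◅◅ q))

  walk-comparable : ∀ {a x y} → Walk a x → Walk a y → Walk x y ⊎ Walk y x
  walk-comparable (here _)   q          = inj₁ q
  walk-comparable (step a p) (here _)   = inj₂ (step a p)
  walk-comparable (step a p) (step b q) rewrite arc-unique a b = walk-comparable p q

  walk-via-parent : ∀ {x y} → Walk x y → x ≢ y → Walk (parent x) y
  walk-via-parent (here _)   x≢x = ⊥-elim (x≢x refl)
  walk-via-parent (step a p) _   rewrite arc⇒parent a = p

  walk-from-sink : ∀ {y} → Walk sink y → y ≡ sink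
  walk-from-sink (here _)   = refl
  walk-from-sink (step a _) = ⊥-elim (sink-has-no-arc a)

  steps : ∀ {x y} → Walk x y → ℕ
  steps (here _)   = 0
  steps (step _ p) = suc (steps p)

  steps-◅◅ : ∀ {x y z} (p : Walk x y) (q : Walk y z) → steps (p ◅◅ q) ≡ steps p ℕ.+ steps q
  steps-◅◅ (here _)   q = refl
  steps-◅◅ (step _ p) q = cong suc (steps-◅◅ p q)

  steps-unique : ∀ {x y} (p q : Walk x y) → steps p ≡ steps q
  steps-unique (here _)   (here _)   = refl
  steps-unique (here _)   (step a q) = ⊥-elim (acyclic a q)
  steps-unique (step a p) (here _)   = ⊥-elim (acyclic a p)
  steps-unique (step a p) (step b q) with arc-unique a b
  ... | refl = cong suc (steps-unique p q)

  ancestor : ℕ → Fin m → Fin m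
  ancestor k v = fold v parent k

  ancestor-walk : ∀ i k v → Σ (Walk (ancestor i v) (ancestor (k ℕ.+ i) v)) λ p → steps p ℕ.≤ k
  ancestor-walk i zero    v = walk-refl , z≤n
  ancestor-walk i (suc k) v with ancestor-walk i k v
  ... | p , |p|≤k = p ◅◅ walk-parent _ , ℕ.≤-trans (ℕ.≤-reflexive (steps-◅◅ p _))
                      (ℕ.≤-trans (ℕ.+-mono-≤ |p|≤k (one-step _)) (ℕ.≤-reflexive (ℕ.+-comm k 1)))
    where
    one-step : ∀ v → steps (walk-parent v) ℕ.≤ 1
    one-step v with v ≟ sink
    ... | yes _ = z≤n
    ... | no _  = s≤s z≤n

  -- Two of the first m + 1 ancestors coincide; the earlier one is the sink, as the tree has no cycle.
  reaches-sink : ∀ v → Σ ℕ λ k → k ℕ.< m × ancestor k v ≡ sink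
  reaches-sink v with Fin.pigeonhole (ℕ.n<1+n m) (λ i → ancestor (toℕ i) v)
  ... | i , j , i<j , same with ancestor (toℕ i) v ≟ sink
  ...   | yes reached = toℕ i , ℕ.<-≤-trans i<j (ℕ.≤-pred (Fin.toℕ<n j)) , reached
  ...   | no ¬reached = ⊥-elim (acyclic (parent-arc ¬reached) back)
    where
    back : Walk (ancestor (suc (toℕ i)) v) (ancestor (toℕ i) v)
    back = subst (Walk _) (trans (cong (λ k → ancestor k v) (ℕ.m∸n+n≡m i<j)) (sym same))
                 (proj₁ (ancestor-walk (suc (toℕ i)) (toℕ j ∸ suc (toℕ i)) v))

  opaque
    private
      steps-subst : ∀ {x y y′} (e : y ≡ y′) (p : Walk x y) → steps (subst (Walk x) e p) ≡ steps p
      steps-subst refl p = refl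

      short-walk-to-sink : ∀ v → Σ (Walk v sink) λ p → steps p ℕ.< m
      short-walk-to-sink v with reaches-sink v
      ... | k , k<m , reached with ancestor-walk 0 k v
      ...   | p , |p|≤k = subst (Walk v) e p , ℕ.≤-<-trans (ℕ.≤-reflexive (steps-subst e p)) (ℕ.≤-<-trans |p|≤k k<m)
        where
        e : ancestor (k ℕ.+ 0) v ≡ sink
        e = trans (cong (λ k → ancestor k v) (ℕ.+-identityʳ k)) reached

    walk-to-sink : ∀ v → Walk v sink
    walk-to-sink v = proj₁ (short-walk-to-sink v)

    depth : Fin m → ℕ
    depth v = steps (walk-to-sink v)

    depth<m : ∀ v → depth v ℕ.< m
    depth<m v = proj₂ (short-walk-to-sink v)

    depth-arc : ∀ {w v} → Arc w v → depth w ≡ suc (depth v)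
    depth-arc {w} {v} a = steps-unique (walk-to-sink w) (step a (walk-to-sink v))

  Arc-wellFounded : WellFounded Arc
  Arc-wellFounded = WF.Subrelation.wellFounded shrinks (On.wellFounded (λ v → m ∸ depth v) <-wellFounded)
    where
    shrinks : ∀ {w v} → Arc w v → m ∸ depth w ℕ.< m ∸ depth v
    shrinks {w} {v} a = ℕ.∸-monoʳ-< (ℕ.≤-reflexive (sym (depth-arc a))) (ℕ.<⇒≤ (depth<m w))

  flip-Arc-wellFounded : WellFounded (flip Arc)
  flip-Arc-wellFounded = WF.Subrelation.wellFounded shrinks (On.wellFounded depth <-wellFounded)
    where
    shrinks : ∀ {v w} → Arc w v → depth v ℕ.< depth w
    shrinks a = ℕ.≤-reflexive (sym (depth-arc a))

  child-induction : (P : Fin m → Set) → (∀ v → (∀ {w} → Arc w v → P w) → P v) → ∀ v → P v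
  child-induction P build = WF.All.wfRec Arc-wellFounded 0ℓ P build

  opaque
    walk? : ∀ x y → Dec (Walk x y)
    walk? x y = WF.All.wfRec flip-Arc-wellFounded 0ℓ (λ x → Dec (Walk x y)) decide x
      where
      decide : ∀ x → (∀ {p} → Arc x p → Dec (Walk p y)) → Dec (Walk x y)
      decide x rec with x ≟ y
      ... | yes refl = yes walk-refl
      ... | no x≢y with x ≟ sink
      ...   | yes refl = no (x≢y ∘ sym ∘ walk-from-sink)
      ...   | no x≢sink with rec (parent-arc x≢sink)
      ...     | yes p≤y = yes (step (parent-arc x≢sink) p≤y)
      ...     | no p≰y  = no (λ x≤y → p≰y (walk-via-parent x≤y x≢y))

  opaque
    arc? : ∀ w v → Dec (Arc w v)
    arc? w v with w ≟ sink
    ... | yes refl = no sink-has-no-arc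
    ... | no w≢sink with parent w ≟ v
    ...   | yes refl = yes (parent-arc w≢sink)
    ...   | no p≢v   = no (p≢v ∘ arc⇒parent)

    source? : ∀ v → Dec (IsSource v)
    source? v with Fin.all? (λ w → ¬? (arc? w v))
    ... | yes none = yes (tt , none)
    ... | no some  = no (some ∘ proj₂)

    match? : ∀ v → Dec (IsMatch v)
    match? v with source? v
    ... | yes src  = no (λ mv → proj₂ mv src)
    ... | no ¬src  = yes (tt , ¬src)

  ¬match⇒source : ∀ {v} → ¬ IsMatch v → IsSource v
  ¬match⇒source {v} ¬mv with source? v
  ... | yes src = src
  ... | no ¬src = ⊥-elim (¬mv (tt , ¬src))

  arc⇒match : ∀ {w v} → Arc w v → IsMatch v
  arc⇒match {w} a = tt , λ src → proj₂ src w a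

  in-neighbour : ∀ {v} → IsMatch v → Σ (Fin m) λ w → Arc w v
  in-neighbour {v} mv with Fin.any? (λ w → arc? w v)
  ... | yes found = found
  ... | no none   = ⊥-elim (proj₂ mv (tt , λ w a → none (w , a)))

  another-in-neighbour : ∀ {v w₀} → Arc w₀ v → Σ (Fin m) λ w₁ → Arc w₁ v × w₁ ≢ w₀
  another-in-neighbour {v} {w₀} a₀ with Fin.any? (λ w → arc? w v ×-dec ¬? (w ≟ w₀))
  ... | yes found = proj₁ found , proj₂ found
  ... | no none   = ⊥-elim (indeg-not-1 v tt (w₀ ∷ [] , ([] ∷ [] , members) , refl))
    where
    members : ∀ x → (x ∈ w₀ ∷ [] → Nin v x) × (Nin v x → x ∈ w₀ ∷ [])
    members x = (λ { (here refl) → a₀ }) , only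
      where
      only : Nin v x → x ∈ w₀ ∷ []
      only a with x ≟ w₀
      ... | yes x≡w₀ = here x≡w₀
      ... | no x≢w₀  = ⊥-elim (none (x , a , x≢w₀))

  walk-to-source : ∀ {a v} → IsSource v → Walk a v → a ≡ v
  walk-to-source src (here _) = refl
  walk-to-source src (step a p) with walk-to-source src p
  ... | refl = ⊥-elim (proj₂ src _ a)

  source-walk-via-arc : ∀ {a x₀ y} → IsSource a → Arc a x₀ → Walk a y → IsMatch y → Walk x₀ y
  source-walk-via-arc src a→x₀ a↝y my =
    subst (λ t → Walk t _) (arc⇒parent a→x₀) (walk-via-parent a↝y (λ { refl → proj₂ my src }))

  last-arc : ∀ {x v} → Walk x v → x ≢ v → Σ (Fin m) λ w → Walk x w × Arc w v
  last-arc (here _) x≢x = ⊥-elim (x≢x refl)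
  last-arc {x} {v} (step {v = y} a p) _ with y ≟ v
  ... | yes refl = x , walk-refl , a
  ... | no y≢v with last-arc p y≢v
  ...   | w , q , b = w , step a q , b

  in-neighbours-ordered⇒equal : ∀ {w₀ w₁ v} → Arc w₀ v → Arc w₁ v → Walk w₀ w₁ → w₀ ≡ w₁
  in-neighbours-ordered⇒equal {w₀} {w₁} a₀ a₁ p with w₀ ≟ w₁
  ... | yes w₀≡w₁ = w₀≡w₁
  ... | no w₀≢w₁  = ⊥-elim (acyclic a₁ (subst (λ t → Walk t _) (arc⇒parent a₀) (walk-via-parent p w₀≢w₁)))

  in-neighbours-below⇒equal : ∀ {w₀ w₁ v z} → Arc w₀ v → Arc w₁ v → Walk z w₀ → Walk z w₁ → w₀ ≡ w₁
  in-neighbours-below⇒equal a₀ a₁ p q with walk-comparable p q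
  ... | inj₁ w₀↝w₁ = in-neighbours-ordered⇒equal a₀ a₁ w₀↝w₁
  ... | inj₂ w₁↝w₀ = sym (in-neighbours-ordered⇒equal a₁ a₀ w₁↝w₀)

  player-below : ∀ v → Σ (Fin m) λ a → IsPlayer a × Walk a v
  player-below = child-induction (λ v → Σ (Fin m) λ a → IsPlayer a × Walk a v) below
    where
    below : ∀ v → (∀ {w} → Arc w v → Σ (Fin m) λ a → IsPlayer a × Walk a w) →
            Σ (Fin m) λ a → IsPlayer a × Walk a v
    below v rec with source? v
    ... | yes src = v , src , walk-refl
    ... | no ¬src with in-neighbour (tt , ¬src)
    ...   | w , a with rec a
    ...     | b , pb , b↝w = b , pb , b↝w ◅◅ arc⇒walk a

  FirstRound : Fin m → Set
  FirstRound x = IsMatch x × (∀ z → Arc z x → IsPlayer z)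

  first-round-below : ∀ {v} → IsMatch v → Σ (Fin m) λ x → FirstRound x × Walk x v
  first-round-below {v} = child-induction (λ v → IsMatch v → Σ (Fin m) λ x → FirstRound x × Walk x v) below v
    where
    below : ∀ v → (∀ {w} → Arc w v → IsMatch w → Σ (Fin m) λ x → FirstRound x × Walk x w) →
            IsMatch v → Σ (Fin m) λ x → FirstRound x × Walk x v
    below v rec mv with Fin.any? (λ w → arc? w v ×-dec match? w)
    ... | no none = v , (mv , λ z a → ¬match⇒source (λ mz → none (z , a , mz))) , walk-refl
    ... | yes (w , a , mw) with rec a mw
    ...   | x , fx , x↝w = x , fx , x↝w ◅◅ arc⇒walk a

  lowest-on-walk : ∀ {r y} (Q : Fin m → Set) → (∀ x → Dec (Q x)) → Walk r y → Q y →
    Σ (Fin m) λ y₀ → Walk r y₀ × Walk y₀ y × Q y₀ × (∀ y′ → Walk r y′ → Walk y′ y₀ → y′ ≢ y₀ → ¬ Q y′)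
  lowest-on-walk {r} Q Q? (here _) qy = r , walk-refl , walk-refl , qy , λ _ r↝y′ y′↝r y′≢r → ⊥-elim (y′≢r (walk-antisym y′↝r r↝y′))
  lowest-on-walk {r} Q Q? (step a p) qy with Q? r
  ... | yes qr = r , walk-refl , step a p , qr , λ _ r↝y′ y′↝r y′≢r → ⊥-elim (y′≢r (walk-antisym y′↝r r↝y′))
  ... | no ¬qr with lowest-on-walk Q Q? p qy
  ...   | y₀ , p↝y₀ , y₀↝y , qy₀ , lowest = y₀ , step a p↝y₀ , y₀↝y , qy₀ , lowest′
    where
    lowest′ : ∀ y′ → Walk r y′ → Walk y′ y₀ → y′ ≢ y₀ → ¬ Q y′
    lowest′ y′ r↝y′ y′↝y₀ y′≢y₀ with r ≟ y′
    ... | yes refl = ¬qr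
    ... | no r≢y′  = lowest y′ (subst (λ t → Walk t y′) (arc⇒parent a) (walk-via-parent r↝y′ r≢y′)) y′↝y₀ y′≢y₀

  highest-above : ∀ x (Q : Fin m → Set) → (∀ x → Dec (Q x)) →
    (Σ (Fin m) λ y → Walk x y × Q y × (∀ y′ → Walk y y′ → y′ ≢ y → ¬ Q y′)) ⊎ (∀ y → Walk x y → ¬ Q y)
  highest-above x Q Q? = along (walk-to-sink x)
    where
    along : ∀ {x} → Walk x sink →
      (Σ (Fin m) λ y → Walk x y × Q y × (∀ y′ → Walk y y′ → y′ ≢ y → ¬ Q y′)) ⊎ (∀ y → Walk x y → ¬ Q y)
    along {x} (here _) with Q? x
    ... | yes qx = inj₁ (x , walk-refl , qx , λ y′ x↝y′ y′≢x → ⊥-elim (y′≢x (walk-from-sink x↝y′)))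
    ... | no ¬qx = inj₂ (λ y x↝y → subst (λ t → ¬ Q t) (sym (walk-from-sink x↝y)) ¬qx)
    along {x} (step a p) with along p
    ... | inj₁ (y , p↝y , qy , highest) = inj₁ (y , step a p↝y , qy , highest)
    ... | inj₂ none with Q? x
    ...   | yes qx = inj₁ (x , walk-refl , qx , λ y′ x↝y′ y′≢x →
                       none y′ (subst (λ t → Walk t y′) (arc⇒parent a) (walk-via-parent x↝y′ (y′≢x ∘ sym))))
    ...   | no ¬qx = inj₂ none′
      where
      none′ : ∀ y → Walk x y → ¬ Q y
      none′ y x↝y with x ≟ y
      ... | yes refl = ¬qx
      ... | no x≢y   = none y (subst (λ t → Walk t y) (arc⇒parent a) (walk-via-parent x↝y x≢y))

  module BracketFacts {B : Fin m → Fin m} (isB : IsBracket B) where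
    open IsBracket isB

    winner-isPlayer : ∀ v → IsPlayer (B v)
    winner-isPlayer v = into-players v tt

    winner-walk : ∀ v → Walk (B v) v
    winner-walk = child-induction (λ v → Walk (B v) v) below
      where
      below : ∀ v → (∀ {w} → Arc w v → Walk (B w) w) → Walk (B v) v
      below v rec with source? v
      ... | yes src = subst (λ t → Walk t v) (sym (on-players v src)) walk-refl
      ... | no ¬src with on-matches v (tt , ¬src)
      ...   | w , a , Bv≡Bw = subst (λ t → Walk t v) (sym Bv≡Bw) (rec a ◅◅ arc⇒walk a)

    wins-below : ∀ {a x y} → B y ≡ a → Walk a x → Walk x y → B x ≡ a
    wins-below By≡a a↝x (here _) = By≡a
    wins-below {a} {x} By≡a a↝x (step {v = x′} a₁ x′↝y) with on-matches x′ (arc⇒match a₁)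
    ... | w , aw , Bx′≡Bw = trans (cong B (sym w≡x)) (trans (sym Bx′≡Bw) Bx′≡a)
      where
      Bx′≡a : B x′ ≡ a
      Bx′≡a = wins-below By≡a (a↝x ◅◅ arc⇒walk a₁) x′↝y
      w≡x : w ≡ x
      w≡x = in-neighbours-below⇒equal aw a₁ (subst (λ t → Walk t w) (trans (sym Bx′≡Bw) Bx′≡a) (winner-walk w)) a↝x

module AtVertex {m : ℕ} (A : Fin m → Fin m → Set) (isSET : Tournament.IsSET A) (u : Fin m) where
  open Tournament A
  open IsSET isSET
  open InTree A isSET
  module 𝒯ᵤ = Sub u

  OuterPlayer : Fin m → Set
  OuterPlayer a = IsPlayer a × ¬ Walk a u

  PreservesOuter : (Fin m → Fin m) → Set
  PreservesOuter G = ∀ y → ¬ Walk y u → ¬ Walk (G y) u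

  outer? : ∀ a → Dec (OuterPlayer a)
  outer? a = source? a ×-dec ¬? (walk? a u)

  count-outer : ∀ {n pu} → Card IsPlayer n → Card (PlayersOf u) pu → Counting.count outer? ≡ n ∸ pu
  count-outer {n} {pu} card-n card-pu = sym (begin
    n ∸ pu                        ≡⟨ cong₂ _∸_ (trans (card≡count source? card-n) (count-split source? (λ a → walk? a u)))
                                               (card≡count inner? card-pu) ⟩
    (count inner? ℕ.+ count outer?) ∸ count inner?  ≡⟨ ℕ.m+n∸m≡n (count inner?) (count outer?) ⟩
    count outer?                  ∎)
    where
    open ≡-Reasoning
    open Counting
    inner? : ∀ a → Dec (PlayersOf u a)
    inner? a = source? a ×-dec walk? a u

  below⇒sub-vertex : ∀ {v} → Walk v u → Vsub u v
  below⇒sub-vertex v↝u a (pa , a↝v) = pa , a↝v ◅◅ v↝u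

  -- If u lay strictly below v, the players entering v off the path from u would be outside P(u).
  sub-vertex⇒below : ∀ {v} → Vsub u v → Walk v u
  sub-vertex⇒below {v} v∈𝒯ᵤ with player-below v
  ... | a , pa , a↝v with walk-comparable a↝v (proj₂ (v∈𝒯ᵤ a (pa , a↝v)))
  ...   | inj₁ v↝u = v↝u
  ...   | inj₂ u↝v with u ≟ v
  ...     | yes refl = walk-refl
  ...     | no u≢v with last-arc u↝v u≢v
  ...       | w₀ , u↝w₀ , a₀ with another-in-neighbour a₀
  ...         | w₁ , a₁ , w₁≢w₀ with player-below w₁
  ...           | b , pb , b↝w₁ = ⊥-elim (w₁≢w₀ (in-neighbours-below⇒equal a₁ a₀ b↝w₁ b↝w₀))
    where
    b↝w₀ : Walk b w₀
    b↝w₀ = proj₂ (v∈𝒯ᵤ b (pb , b↝w₁ ◅◅ arc⇒walk a₁)) ◅◅ u↝w₀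

  sub-source⇒ : ∀ {v} → 𝒯ᵤ.IsSource v → Walk v u × IsSource v
  sub-source⇒ (v∈𝒯ᵤ , none) =
    sub-vertex⇒below v∈𝒯ᵤ ,
    tt , λ w a → none w (below⇒sub-vertex (arc⇒walk a ◅◅ sub-vertex⇒below v∈𝒯ᵤ) , v∈𝒯ᵤ , proj₂ (proj₂ a))

  sub-source⇐ : ∀ {v} → Walk v u → IsSource v → 𝒯ᵤ.IsSource v
  sub-source⇐ v↝u src = below⇒sub-vertex v↝u , λ w a → proj₂ src w (tt , tt , proj₂ (proj₂ a))

  sub-match⇒ : ∀ {v} → 𝒯ᵤ.IsMatch v → Walk v u × IsMatch v
  sub-match⇒ {v} (v∈𝒯ᵤ , ¬src) = v↝u , tt , ¬src ∘ sub-source⇐ v↝u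
    where
    v↝u : Walk v u
    v↝u = sub-vertex⇒below v∈𝒯ᵤ

  sub-match⇐ : ∀ {v} → Walk v u → IsMatch v → 𝒯ᵤ.IsMatch v
  sub-match⇐ v↝u mv = below⇒sub-vertex v↝u , proj₂ mv ∘ proj₂ ∘ sub-source⇒

  sub-arc⇒ : ∀ {x w} → 𝒯ᵤ.Nin x w → Arc w x
  sub-arc⇒ (_ , _ , a) = tt , tt , a

  sub-arc⇐ : ∀ {x w} → Walk x u → Arc w x → 𝒯ᵤ.Nin x w
  sub-arc⇐ x↝u a = below⇒sub-vertex (arc⇒walk a ◅◅ x↝u) , below⇒sub-vertex x↝u , proj₂ (proj₂ a)

  restrict-bracket : ∀ {B} → IsBracket B → 𝒯ᵤ.IsBracket B
  restrict-bracket {B} isB = record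
    { into-players = λ v v∈𝒯ᵤ → sub-source⇐ (winner-walk v ◅◅ sub-vertex⇒below v∈𝒯ᵤ) (winner-isPlayer v)
    ; on-players   = λ a src → IsBracket.on-players isB a (proj₂ (sub-source⇒ src))
    ; on-matches   = on-matches
    }
    where
    open BracketFacts isB
    on-matches : ∀ x → 𝒯ᵤ.IsMatch x → Σ (Fin m) λ v → 𝒯ᵤ.Nin x v × B x ≡ B v
    on-matches x mx with sub-match⇒ mx
    ... | x↝u , mx′ with IsBracket.on-matches isB x mx′
    ...   | w , a , Bx≡Bw = w , sub-arc⇐ x↝u a , Bx≡Bw

  off-path-in-neighbour : ∀ {v} → IsMatch v → Σ (Fin m) λ w → Arc w v × ¬ Walk u w
  off-path-in-neighbour mv with in-neighbour mv
  ... | w₀ , a₀ with walk? u w₀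
  ...   | no u↝̸w₀ = w₀ , a₀ , u↝̸w₀
  ...   | yes u↝w₀ with another-in-neighbour a₀
  ...     | w₁ , a₁ , w₁≢w₀ = w₁ , a₁ , λ u↝w₁ → w₁≢w₀ (in-neighbours-below⇒equal a₁ a₀ u↝w₁ u↝w₀)

  private
    off-path? : ∀ v → Dec (Σ (Fin m) λ w → Arc w v × ¬ Walk u w)
    off-path? v = Fin.any? (λ w → arc? w v ×-dec ¬? (walk? u w))

  default-pick : Fin m → Fin m
  default-pick v with off-path? v
  ... | yes (w , _) = w
  ... | no _        = v

  default-pick-arc : ∀ {v} → IsMatch v → Arc (default-pick v) v
  default-pick-arc {v} mv with off-path? v
  ... | yes (_ , a , _) = a
  ... | no none         = ⊥-elim (none (off-path-in-neighbour mv))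

  default-pick-off-path : ∀ {v} → IsMatch v → ¬ Walk u (default-pick v)
  default-pick-off-path {v} mv with off-path? v
  ... | yes (_ , _ , u↝̸w) = u↝̸w
  ... | no none            = ⊥-elim (none (off-path-in-neighbour mv))

  default-pick-source : ∀ {a} → IsSource a → default-pick a ≡ a
  default-pick-source {a} src with off-path? a
  ... | yes (w , arc , _) = ⊥-elim (proj₂ src w arc)
  ... | no _              = refl

  -- m rounds of default-pick reach a player from any vertex: each round increases the depth, which is < m.
  default : Fin m → Fin m
  default v = iterate default-pick v m

  private
    fixed : ∀ {a} k → IsSource a → iterate default-pick a k ≡ a
    fixed zero    src = refl
    fixed (suc k) src rewrite default-pick-source src = fixed k src

    no-fuel : ∀ {v} → ¬ (m ℕ.≤ depth v ℕ.+ 0)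
    no-fuel {v} m≤d = ℕ.<⇒≱ (depth<m v) (subst (m ℕ.≤_) (ℕ.+-identityʳ _) m≤d)

    refuel : ∀ {v k} → IsMatch v → m ℕ.≤ depth v ℕ.+ suc k → m ℕ.≤ depth (default-pick v) ℕ.+ k
    refuel {v} {k} mv = subst (m ℕ.≤_) (trans (ℕ.+-suc _ k) (cong (ℕ._+ k) (sym (depth-arc (default-pick-arc mv)))))

    iterate-player : ∀ k v → m ℕ.≤ depth v ℕ.+ k → IsSource (iterate default-pick v k)
    iterate-player zero    v m≤d = ⊥-elim (no-fuel m≤d)
    iterate-player (suc k) v m≤d with match? v
    ... | yes mv = iterate-player k (default-pick v) (refuel mv m≤d)
    ... | no ¬mv = subst IsSource (sym (fixed (suc k) src)) src
      where
      src : IsSource v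
      src = ¬match⇒source ¬mv

    iterate-stable : ∀ k v → m ℕ.≤ depth v ℕ.+ k → iterate default-pick v (suc k) ≡ iterate default-pick v k
    iterate-stable zero    v m≤d = ⊥-elim (no-fuel m≤d)
    iterate-stable (suc k) v m≤d with match? v
    ... | yes mv = iterate-stable k (default-pick v) (refuel mv m≤d)
    ... | no ¬mv = trans (fixed (suc (suc k)) src) (sym (fixed (suc k) src))
      where
      src : IsSource v
      src = ¬match⇒source ¬mv

  default-bracket : IsBracket default
  default-bracket = record
    { into-players = λ v _ → iterate-player m v (ℕ.m≤n+m m (depth v))
    ; on-players   = λ a src → fixed m src
    ; on-matches   = λ x mx → default-pick x , default-pick-arc mx ,
                       sym (iterate-stable m x (ℕ.m≤n+m m (depth x)))
    }

  default-match : ∀ x → default x ≡ default (default-pick x)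
  default-match x = sym (iterate-stable m x (ℕ.m≤n+m m (depth x)))

  open BracketFacts default-bracket using () renaming (winner-walk to default-walk)

  default-preserves-outer : PreservesOuter default
  default-preserves-outer y y↝̸u Dy↝u with walk-comparable (default-walk y) Dy↝u
  ... | inj₁ y↝u = y↝̸u y↝u
  ... | inj₂ u↝y with match? y
  ...   | no ¬my = y↝̸u (subst (λ t → Walk t u) (fixed m (¬match⇒source ¬my)) Dy↝u)
  ...   | yes my with u ≟ y
  ...     | yes refl = y↝̸u walk-refl
  ...     | no u≢y with walk-comparable (default-walk (default-pick y)) (subst (λ t → Walk t u) (default-match y) Dy↝u)
  ...       | inj₂ u↝w = default-pick-off-path my u↝w
  ...       | inj₁ w↝u with default-pick y ≟ u
  ...         | yes w≡u = default-pick-off-path my (subst (Walk u) (sym w≡u) walk-refl)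
  ...         | no w≢u  = y↝̸u (subst (λ t → Walk t u) (arc⇒parent (default-pick-arc my)) (walk-via-parent w↝u w≢u))

  opaque
    champion : Fin m → (Fin m → Fin m) → Fin m → Fin m
    champion a C v with walk? a v
    ... | yes _ = a
    ... | no _  = C v

    champion-on-path : ∀ {a C v} → Walk a v → champion a C v ≡ a
    champion-on-path {a} {C} {v} a↝v with walk? a v
    ... | yes _   = refl
    ... | no a↝̸v = ⊥-elim (a↝̸v a↝v)

    champion-off-path : ∀ {a C v} → ¬ Walk a v → champion a C v ≡ C v
    champion-off-path {a} {C} {v} a↝̸v with walk? a v
    ... | yes a↝v = ⊥-elim (a↝̸v a↝v)
    ... | no _    = refl

    champion-bracket : ∀ {a C} → IsPlayer a → IsBracket C → IsBracket (champion a C)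
    champion-bracket {a} {C} pa isC = record
      { into-players = into-players
      ; on-players   = on-players
      ; on-matches   = on-matches
      }
      where
      module C = IsBracket isC
      into-players : ∀ v → ⊤ → IsPlayer (champion a C v)
      into-players v _ with walk? a v
      ... | yes _ = pa
      ... | no _  = C.into-players v tt
      on-players : ∀ v → IsPlayer v → champion a C v ≡ v
      on-players v pv with walk? a v
      ... | yes a↝v = walk-to-source pv a↝v
      ... | no _    = C.on-players v pv
      on-matches : ∀ x → IsMatch x → Σ (Fin m) λ w → Nin x w × champion a C x ≡ champion a C w
      on-matches x mx with walk? a x
      ... | yes a↝x with last-arc a↝x (λ { refl → proj₂ mx pa })
      ...   | w , a↝w , w→x = w , w→x , sym (champion-on-path a↝w)
      on-matches x mx | no a↝̸x with C.on-matches x mx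
      ...   | w , w→x , Cx≡Cw = w , w→x , trans Cx≡Cw (sym (champion-off-path (λ a↝w → a↝̸x (a↝w ◅◅ arc⇒walk w→x))))

  champion-preserves-outer : ∀ {a C} → ¬ Walk a u → PreservesOuter C → PreservesOuter (champion a C)
  champion-preserves-outer {a} {C} a↝̸u C-outer y y↝̸u with walk? a y
  ... | yes a↝y = subst (λ t → ¬ Walk t u) (sym (champion-on-path a↝y)) a↝̸u
  ... | no a↝̸y  = subst (λ t → ¬ Walk t u) (sym (champion-off-path a↝̸y)) (C-outer y y↝̸u)

  opaque
    glue : (Fin m → Fin m) → (Fin m → Fin m) → Fin m → Fin m
    glue ρ G v with walk? v u
    ... | yes _ = ρ v
    ... | no _  = G v

    glue-inner : ∀ {ρ G v} → Walk v u → glue ρ G v ≡ ρ v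
    glue-inner {ρ} {G} {v} v↝u with walk? v u
    ... | yes _   = refl
    ... | no v↝̸u = ⊥-elim (v↝̸u v↝u)

    glue-outer : ∀ {ρ G v} → ¬ Walk v u → glue ρ G v ≡ G v
    glue-outer {ρ} {G} {v} v↝̸u with walk? v u
    ... | yes v↝u = ⊥-elim (v↝̸u v↝u)
    ... | no _    = refl

    glue-bracket : ∀ {ρ G} → 𝒯ᵤ.IsBracket ρ → IsBracket G → PreservesOuter G → IsBracket (glue ρ G)
    glue-bracket {ρ} {G} isρ isG G-outer = record
      { into-players = into-players
      ; on-players   = on-players
      ; on-matches   = on-matches
      }
      where
      module ρ = 𝒯ᵤ.IsBracket isρ
      module G = IsBracket isG
      into-players : ∀ v → ⊤ → IsPlayer (glue ρ G v)
      into-players v _ with walk? v u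
      ... | yes v↝u = proj₂ (sub-source⇒ (ρ.into-players v (below⇒sub-vertex v↝u)))
      ... | no _    = G.into-players v tt
      on-players : ∀ v → IsPlayer v → glue ρ G v ≡ v
      on-players v pv with walk? v u
      ... | yes v↝u = ρ.on-players v (sub-source⇐ v↝u pv)
      ... | no _    = G.on-players v pv
      on-matches : ∀ x → IsMatch x → Σ (Fin m) λ w → Nin x w × glue ρ G x ≡ glue ρ G w
      on-matches x mx with walk? x u
      ... | yes x↝u with ρ.on-matches x (sub-match⇐ x↝u mx)
      ...   | w , w→x , ρx≡ρw = w , sub-arc⇒ w→x ,
                                trans ρx≡ρw (sym (glue-inner (arc⇒walk (sub-arc⇒ w→x) ◅◅ x↝u)))
      on-matches x mx | no x↝̸u with G.on-matches x mx
      ...   | w , w→x , Gx≡Gw = w , w→x , trans Gx≡Gw (sym (glue-outer w↝̸u))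
        where
        -- G x is an outer player and wins w, so w cannot lie below u
        w↝̸u : ¬ Walk w u
        w↝̸u w↝u = G-outer x x↝̸u (subst (λ t → Walk t u) (sym Gx≡Gw) (BracketFacts.winner-walk isG w ◅◅ w↝u))

agree : ∀ {m} → Fin m → Fin m → ℕ
agree a b = 𝟙 (a ≟ b)

module _ {m : ℕ} {x z p q : Fin m} where

  exchange-same : x ≡ z → agree x q ℕ.+ agree z p ℕ.≤ agree x p ℕ.+ agree z q
  exchange-same refl = ℕ.≤-reflexive (ℕ.+-comm (agree x q) (agree x p))

  exchange-mono : (q ≡ x → p ≡ x) → (p ≡ z → q ≡ z) → agree x q ℕ.+ agree z p ℕ.≤ agree x p ℕ.+ agree z q
  exchange-mono q⇒p p⇒q =
    ℕ.+-mono-≤ (𝟙-mono (x ≟ q) (x ≟ p) (sym ∘ q⇒p ∘ sym)) (𝟙-mono (z ≟ p) (z ≟ q) (sym ∘ p⇒q ∘ sym))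

  exchange-winner : p ≡ x → agree x q ℕ.+ agree z p ℕ.≤ agree x p ℕ.+ agree z q
  exchange-winner refl with q ≟ p
  ... | yes refl = ℕ.≤-refl
  ... | no q≢p   = begin
    agree p q ℕ.+ agree z p   ≡⟨ cong (ℕ._+ agree z p) (𝟙-no (p ≟ q) (q≢p ∘ sym)) ⟩
    agree z p                 ≤⟨ 𝟙≤1 (z ≟ p) ⟩
    1                         ≡⟨ sym (𝟙-yes (p ≟ p) refl) ⟩
    agree p p                 ≤⟨ ℕ.m≤m+n (agree p p) (agree z q) ⟩
    agree p p ℕ.+ agree z q   ∎
    where open ℕ.≤-Reasoning

  exchange-strict : p ≡ x → q ≢ x → z ≢ x → agree x q ℕ.+ agree z p ℕ.< agree x p ℕ.+ agree z q
  exchange-strict refl q≢p z≢p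
    rewrite 𝟙-no (p ≟ q) (q≢p ∘ sym) | 𝟙-no (z ≟ p) z≢p | 𝟙-yes (p ≟ p) refl = s≤s z≤n

module Scores {m : ℕ} (A : Fin m → Fin m → Set) (isSET : Tournament.IsSET A) (u : Fin m)
              (R : Reals) (σ : Fin m → Reals.ℝ R) (σ-pos : Tournament.IsScoring A R σ) where
  open Tournament A
  open InTree A isSET
  open AtVertex A isSET u
  open Reals R
  open RealOrder R
  open IsCommutativeRing isCommutativeRing using (+-isCommutativeMonoid; +-identityˡ; +-identityʳ)
  open IndicatorSum +-isCommutativeMonoid using (∑[_]; foldr≡∑; ∑-distrib-+; sum-cong-≗; ×-homo-+)

  Agrees? : (X B : Fin m → Fin m) → Decidable (λ y → IsMatch y × X y ≡ B y)
  Agrees? X B y = match? y ×-dec (X y ≟ B y)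

  sub-match? : ∀ y → Dec (𝒯ᵤ.IsMatch y)
  sub-match? y with walk? y u | match? y
  ... | yes y↝u | yes my = yes (sub-match⇐ y↝u my)
  ... | no y↝̸u  | _      = no (y↝̸u ∘ proj₁ ∘ sub-match⇒)
  ... | _       | no ¬my = no (¬my ∘ proj₂ ∘ sub-match⇒)

  InnerAgrees? : (X B : Fin m → Fin m) → Decidable (λ y → 𝒯ᵤ.IsMatch y × X y ≡ B y)
  InnerAgrees? X B y = sub-match? y ×-dec (X y ≟ B y)

  OuterAgrees? : (X B : Fin m → Fin m) → Decidable (λ y → (IsMatch y × ¬ Walk y u) × X y ≡ B y)
  OuterAgrees? X B y = (match? y ×-dec ¬? (walk? y u)) ×-dec (X y ≟ B y)

  score inner-score outer-score : (X B : Fin m → Fin m) → ℝ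
  score       X B = ∑[ Agrees? X B ] σ
  inner-score X B = ∑[ InnerAgrees? X B ] σ
  outer-score X B = ∑[ OuterAgrees? X B ] σ

  score-exists : ∀ X B → ScoreIs R σ X B (score X B)
  score-exists X B with enumeration (Agrees? X B)
  ... | xs , enum = xs , enum , sym (foldr≡∑ (Agrees? X B) σ enum)

  inner-score-unique : ∀ {X B s} → 𝒯ᵤ.ScoreIs R σ X B s → s ≡ inner-score X B
  inner-score-unique {X} {B} (xs , enum , s≡) = trans s≡ (foldr≡∑ (InnerAgrees? X B) σ enum)

  score-glue : ∀ ρ G B → score (glue ρ G) B ≡ inner-score ρ B + outer-score G B
  score-glue ρ G B = begin
    score (glue ρ G) B
      ≡⟨ sum-cong-≗ (λ y → cong (_· σ y) (split y (walk? y u))) ⟩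
    sum (λ y → (𝟙 (InnerAgrees? ρ B y) ℕ.+ 𝟙 (OuterAgrees? G B y)) · σ y)
      ≡⟨ sum-cong-≗ (λ y → ×-homo-+ (σ y) (𝟙 (InnerAgrees? ρ B y)) (𝟙 (OuterAgrees? G B y))) ⟩
    sum (λ y → 𝟙 (InnerAgrees? ρ B y) · σ y + 𝟙 (OuterAgrees? G B y) · σ y)
      ≡⟨ ∑-distrib-+ (λ y → 𝟙 (InnerAgrees? ρ B y) · σ y) (λ y → 𝟙 (OuterAgrees? G B y) · σ y) ⟩
    inner-score ρ B + outer-score G B
      ∎
    where
    open ≡-Reasoning
    split : ∀ y → Dec (Walk y u) → 𝟙 (Agrees? (glue ρ G) B y) ≡ 𝟙 (InnerAgrees? ρ B y) ℕ.+ 𝟙 (OuterAgrees? G B y)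
    split y (yes y↝u) = begin
      𝟙 (Agrees? (glue ρ G) B y)           ≡⟨ 𝟙-cong (Agrees? (glue ρ G) B y) (InnerAgrees? ρ B y)
                                                (λ (my , e) → sub-match⇐ y↝u my , trans (sym (glue-inner y↝u)) e)
                                                (λ (my , e) → proj₂ (sub-match⇒ my) , trans (glue-inner y↝u) e) ⟩
      𝟙 (InnerAgrees? ρ B y)               ≡⟨ sym (ℕ.+-identityʳ _) ⟩
      𝟙 (InnerAgrees? ρ B y) ℕ.+ 0         ≡⟨ cong (_ ℕ.+_) (sym (𝟙-no (OuterAgrees? G B y) (λ ((_ , y↝̸u) , _) → y↝̸u y↝u))) ⟩
      _                                    ∎
    split y (no y↝̸u) = begin
      𝟙 (Agrees? (glue ρ G) B y)           ≡⟨ 𝟙-cong (Agrees? (glue ρ G) B y) (OuterAgrees? G B y)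
                                                (λ (my , e) → (my , y↝̸u) , trans (sym (glue-outer y↝̸u)) e)
                                                (λ ((my , _) , e) → my , trans (glue-outer y↝̸u) e) ⟩
      𝟙 (OuterAgrees? G B y)               ≡⟨ cong (ℕ._+ _) (sym (𝟙-no (InnerAgrees? ρ B y) (y↝̸u ∘ proj₁ ∘ sub-match⇒ ∘ proj₁))) ⟩
      _                                    ∎

  outer-score-cong : ∀ {G B B′} →
    (∀ y → IsMatch y → ¬ Walk y u → (G y ≡ B y → G y ≡ B′ y) × (G y ≡ B′ y → G y ≡ B y)) →
    outer-score G B ≡ outer-score G B′
  outer-score-cong {G} {B} {B′} same = sum-cong-≗ λ y → cong (_· σ y)
    (𝟙-cong (OuterAgrees? G B y) (OuterAgrees? G B′ y)
      (λ ((my , y↝̸u) , e) → (my , y↝̸u) , proj₁ (same y my y↝̸u) e)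
      (λ ((my , y↝̸u) , e) → (my , y↝̸u) , proj₂ (same y my y↝̸u) e))

  opaque
    straight cross : (X Y B B′ : Fin m → Fin m) → Fin m → ℕ
    straight X Y B B′ y = agree (X y) (B y) ℕ.+ agree (Y y) (B′ y)
    cross    X Y B B′ y = agree (X y) (B′ y) ℕ.+ agree (Y y) (B y)

    private
      pair-count : (X B Y B′ : Fin m → Fin m) → Fin m → ℕ
      pair-count X B Y B′ y = 𝟙 (Agrees? X B y) ℕ.+ 𝟙 (Agrees? Y B′ y)

      score-pair : ∀ X B Y B′ → score X B + score Y B′ ≡ sum (λ y → pair-count X B Y B′ y · σ y)
      score-pair X B Y B′ = sym (trans (sum-cong-≗ λ y → ×-homo-+ (σ y) (𝟙 (Agrees? X B y)) (𝟙 (Agrees? Y B′ y)))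
                                       (∑-distrib-+ (λ y → 𝟙 (Agrees? X B y) · σ y) (λ y → 𝟙 (Agrees? Y B′ y) · σ y)))

      pair-count-match : ∀ X B Y B′ y → IsMatch y → pair-count X B Y B′ y ≡ agree (X y) (B y) ℕ.+ agree (Y y) (B′ y)
      pair-count-match X B Y B′ y my = cong₂ ℕ._+_
        (𝟙-cong (Agrees? X B y) (X y ≟ B y) proj₂ (my ,_))
        (𝟙-cong (Agrees? Y B′ y) (Y y ≟ B′ y) proj₂ (my ,_))

      pair-count-non-match : ∀ X B Y B′ y → ¬ IsMatch y → pair-count X B Y B′ y ≡ 0
      pair-count-non-match X B Y B′ y ¬my =
        cong₂ ℕ._+_ (𝟙-no (Agrees? X B y) (¬my ∘ proj₁)) (𝟙-no (Agrees? Y B′ y) (¬my ∘ proj₁))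

    score-exchange-< : ∀ X Y B B′ → (∀ y → IsMatch y → cross X Y B B′ y ℕ.≤ straight X Y B B′ y) →
                       ∀ y₀ → IsMatch y₀ → cross X Y B B′ y₀ ℕ.< straight X Y B B′ y₀ →
                       score X B′ + score Y B < score X B + score Y B′
    score-exchange-< X Y B B′ cross≤ y₀ my₀ cross< =
      subst₂ _<_ (sym (score-pair X B′ Y B)) (sym (score-pair X B Y B′))
        (∑-mono-< (λ y → pointwise y (match? y)) y₀ strict)
      where
      pointwise : ∀ y → Dec (IsMatch y) → pair-count X B′ Y B y · σ y ≤ pair-count X B Y B′ y · σ y
      pointwise y (yes my)
        rewrite pair-count-match X B′ Y B y my | pair-count-match X B Y B′ y my = ·-monoˡ-≤ (σ-pos y my) (cross≤ y my)
      pointwise y (no ¬my)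
        rewrite pair-count-non-match X B′ Y B y ¬my | pair-count-non-match X B Y B′ y ¬my = ≤-refl
      strict : pair-count X B′ Y B y₀ · σ y₀ < pair-count X B Y B′ y₀ · σ y₀
      strict rewrite pair-count-match X B′ Y B y₀ my₀ | pair-count-match X B Y B′ y₀ my₀ = ·-monoˡ-< (σ-pos y₀ my₀) cross<

    cross-same : ∀ {X Y B B′ y} → X y ≡ Y y → cross X Y B B′ y ℕ.≤ straight X Y B B′ y
    cross-same = exchange-same

    cross-mono : ∀ {X Y B B′ y x z} → X y ≡ x → Y y ≡ z → (B′ y ≡ x → B y ≡ x) → (B y ≡ z → B′ y ≡ z) →
                 cross X Y B B′ y ℕ.≤ straight X Y B B′ y
    cross-mono refl refl = exchange-mono

    cross-winner : ∀ {X Y B B′ y} → B y ≡ X y → cross X Y B B′ y ℕ.≤ straight X Y B B′ y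
    cross-winner = exchange-winner

    cross-strict : ∀ {X Y B B′ y x z} → X y ≡ x → Y y ≡ z → B y ≡ x → B′ y ≢ x → z ≢ x →
                   cross X Y B B′ y ℕ.< straight X Y B B′ y
    cross-strict refl refl = exchange-strict

  score-exchange : ∀ X Y B B′ → (∀ y → IsMatch y → cross X Y B B′ y ℕ.≤ straight X Y B B′ y) →
                   ∀ y₀ → IsMatch y₀ → cross X Y B B′ y₀ ℕ.< straight X Y B B′ y₀ →
                   score X B ≡ score X B′ → score Y B ≡ score Y B′ → ⊥
  score-exchange X Y B B′ cross≤ y₀ my₀ cross< eX eY =
    <⇒≢ (score-exchange-< X Y B B′ cross≤ y₀ my₀ cross<) (cong₂ _+_ (sym eX) eY)

module Decoding {m : ℕ} (A : Fin m → Fin m → Set) (isSET : Tournament.IsSET A) (u : Fin m)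
                (R : Reals) (σ : Fin m → Reals.ℝ R) (σ-pos : Tournament.IsScoring A R σ) where
  open Tournament A
  open IsSET isSET using (sink)
  open InTree A isSET
  open AtVertex A isSET u
  open Scores A isSET u R σ σ-pos

  favouring : Fin m → Fin m → Fin m
  favouring a = champion a default

  glued : (Fin m → Fin m) → Fin m → Fin m → Fin m
  glued ρ a = glue ρ (favouring a)

  glued-on-path : ∀ {ρ a y} → ¬ Walk y u → Walk a y → glued ρ a y ≡ a
  glued-on-path y↝̸u a↝y = trans (glue-outer y↝̸u) (champion-on-path a↝y)

  glued-off-path : ∀ {ρ a y} → ¬ Walk y u → ¬ Walk a y → glued ρ a y ≡ default y
  glued-off-path y↝̸u a↝̸y = trans (glue-outer y↝̸u) (champion-off-path a↝̸y)

  glued-inner : ∀ {ρ a b y} → Walk y u → glued ρ a y ≡ glued ρ b y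
  glued-inner y↝u = trans (glue-inner y↝u) (sym (glue-inner y↝u))

  Indistinguishable : (B B′ X : Fin m → Fin m) → Set
  Indistinguishable B B′ X = score X B ≡ score X B′

  Straight≥Cross Straight>Cross : (ρ : Fin m → Fin m) (a b : Fin m) (B B′ : Fin m → Fin m) → Fin m → Set
  Straight≥Cross ρ a b B B′ y = cross (glued ρ a) (glued ρ b) B B′ y ℕ.≤ straight (glued ρ a) (glued ρ b) B B′ y
  Straight>Cross ρ a b B B′ y = cross (glued ρ a) (glued ρ b) B B′ y ℕ.< straight (glued ρ a) (glued ρ b) B B′ y

  glued-exchange : ∀ ρ {a b B B′} y₀ → IsMatch y₀ → Straight>Cross ρ a b B B′ y₀ →
    (∀ {y} → IsMatch y → ¬ Walk y u → Walk a y → Walk b y → Straight≥Cross ρ a b B B′ y) →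
    (∀ {y} → IsMatch y → ¬ Walk y u → Walk a y → ¬ Walk b y → Straight≥Cross ρ a b B B′ y) →
    (∀ {y} → IsMatch y → ¬ Walk y u → ¬ Walk a y → Walk b y → Straight≥Cross ρ a b B B′ y) →
    Indistinguishable B B′ (glued ρ a) → Indistinguishable B B′ (glued ρ b) → ⊥
  glued-exchange ρ {a} {b} {B} {B′} y₀ my₀ strict both a-only b-only =
    score-exchange (glued ρ a) (glued ρ b) B B′ cross≤ y₀ my₀ strict
    where
    cross≤ : ∀ y → IsMatch y → Straight≥Cross ρ a b B B′ y
    cross≤ y my with walk? y u | walk? a y | walk? b y
    ... | yes y↝u | _       | _       = cross-same (glued-inner y↝u)
    ... | no y↝̸u  | yes a↝y | yes b↝y = both my y↝̸u a↝y b↝y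
    ... | no y↝̸u  | yes a↝y | no b↝̸y  = a-only my y↝̸u a↝y b↝̸y
    ... | no y↝̸u  | no a↝̸y  | yes b↝y = b-only my y↝̸u a↝̸y b↝y
    ... | no y↝̸u  | no a↝̸y  | no b↝̸y  = cross-same (trans (glued-off-path y↝̸u a↝̸y) (sym (glued-off-path y↝̸u b↝̸y)))

  EqualOrBothInner : Fin m → Fin m → Set
  EqualOrBothInner a b = a ≡ b ⊎ (Walk a u × Walk b u)

  equalOrBothInner? : ∀ a b → Dec (EqualOrBothInner a b)
  equalOrBothInner? a b = (a ≟ b) ⊎-dec (walk? a u ×-dec walk? b u)

  equalOrBothInner-sym : ∀ {a b} → EqualOrBothInner a b → EqualOrBothInner b a
  equalOrBothInner-sym (inj₁ e)         = inj₁ (sym e)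
  equalOrBothInner-sym (inj₂ (p , p′)) = inj₂ (p′ , p)

  equalOrBothInner⇒outer-alike : ∀ {a b g} → EqualOrBothInner a b → ¬ Walk g u → (a ≡ g → b ≡ g) × (b ≡ g → a ≡ g)
  equalOrBothInner⇒outer-alike (inj₁ e) _ = trans (sym e) , trans e
  equalOrBothInner⇒outer-alike (inj₂ (p , p′)) g↝̸u =
    (λ { refl → ⊥-elim (g↝̸u p) }) , (λ { refl → ⊥-elim (g↝̸u p′) })

  OuterAgreement : (B B′ : Fin m → Fin m) → Set
  OuterAgreement B B′ = ∀ y → IsMatch y → ¬ Walk y u → EqualOrBothInner (B y) (B′ y)

  WinsAlike : (B B′ : Fin m → Fin m) → Fin m → Set
  WinsAlike B B′ a = ∀ y → (B y ≡ a → B′ y ≡ a) × (B′ y ≡ a → B y ≡ a)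

  module Between {B B′ : Fin m → Fin m} (isB : IsBracket B) (isB′ : IsBracket B′) where
    module 𝔅  = BracketFacts isB
    module 𝔅′ = BracketFacts isB′

    pair-wins-alike : ∀ ρ {a b x₀} → OuterPlayer a → OuterPlayer b → Arc a x₀ → Arc b x₀ → a ≢ b →
      Indistinguishable B B′ (glued ρ a) → Indistinguishable B B′ (glued ρ b) → ∀ y → B y ≡ a → B′ y ≡ a
    pair-wins-alike ρ {a} {b} {x₀} (pa , a↝̸u) (pb , b↝̸u) a→x₀ b→x₀ a≢b a-indist b-indist y₁ By₁≡a with B′ y₁ ≟ a
    ... | yes B′y₁≡a = B′y₁≡a
    ... | no B′y₁≢a  = ⊥-elim (glued-exchange ρ y₁ my₁ strict both a-only b-only a-indist b-indist)
      where
      a↝y₁ : Walk a y₁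
      a↝y₁ = subst (λ t → Walk t y₁) By₁≡a (𝔅.winner-walk y₁)
      my₁ : IsMatch y₁
      my₁ with match? y₁
      ... | yes my₁ = my₁
      ... | no ¬my₁ = ⊥-elim (B′y₁≢a (trans (IsBracket.on-players isB′ y₁ src) (sym (walk-to-source src a↝y₁))))
        where
        src : IsSource y₁
        src = ¬match⇒source ¬my₁
      y₁↝̸u : ¬ Walk y₁ u
      y₁↝̸u y₁↝u = a↝̸u (a↝y₁ ◅◅ y₁↝u)
      x₀↝y₁ : Walk x₀ y₁
      x₀↝y₁ = source-walk-via-arc pa a→x₀ a↝y₁ my₁
      strict : Straight>Cross ρ a b B B′ y₁
      strict = cross-strict (glued-on-path y₁↝̸u a↝y₁) (glued-on-path y₁↝̸u (step b→x₀ x₀↝y₁)) By₁≡a B′y₁≢a (a≢b ∘ sym)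
      both : ∀ {y} → IsMatch y → ¬ Walk y u → Walk a y → Walk b y → Straight≥Cross ρ a b B B′ y
      both {y} my y↝̸u a↝y b↝y = cross-mono (glued-on-path y↝̸u a↝y) (glued-on-path y↝̸u b↝y) a-alike b-absent
        where
        x₀↝y : Walk x₀ y
        x₀↝y = source-walk-via-arc pa a→x₀ a↝y my
        a-alike : B′ y ≡ a → B y ≡ a
        a-alike B′y≡a with walk-comparable x₀↝y x₀↝y₁
        ... | inj₁ y↝y₁ = 𝔅.wins-below By₁≡a a↝y y↝y₁
        ... | inj₂ y₁↝y = ⊥-elim (B′y₁≢a (𝔅′.wins-below B′y≡a a↝y₁ y₁↝y))
        b-absent : B y ≡ b → B′ y ≡ b
        b-absent By≡b = ⊥-elim (a≢b (trans (sym (𝔅.wins-below By₁≡a (arc⇒walk a→x₀) x₀↝y₁))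
                                          (𝔅.wins-below By≡b (arc⇒walk b→x₀) x₀↝y)))
      a-only : ∀ {y} → IsMatch y → ¬ Walk y u → Walk a y → ¬ Walk b y → Straight≥Cross ρ a b B B′ y
      a-only my _ a↝y b↝̸y = ⊥-elim (b↝̸y (step b→x₀ (source-walk-via-arc pa a→x₀ a↝y my)))
      b-only : ∀ {y} → IsMatch y → ¬ Walk y u → ¬ Walk a y → Walk b y → Straight≥Cross ρ a b B B′ y
      b-only my _ a↝̸y b↝y = ⊥-elim (a↝̸y (step a→x₀ (source-walk-via-arc pb b→x₀ b↝y my)))

    module Anchored (ρ₀ : Fin m → Fin m) (r : Fin m) (r-outer : OuterPlayer r) (r-alike : WinsAlike B B′ r)
                    (r-indist : Indistinguishable B B′ (glued ρ₀ r)) where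

      disagreement-on-anchor-path : ∀ {y₀} → IsMatch y₀ → Walk r y₀ → B y₀ ≢ B′ y₀ → ¬ Walk (B y₀) u →
        (∀ y → Walk r y → Walk y y₀ → y ≢ y₀ → IsMatch y → EqualOrBothInner (B y) (B′ y)) →
        Indistinguishable B B′ (glued ρ₀ (B y₀)) → ⊥
      disagreement-on-anchor-path {y₀} my₀ r↝y₀ B≢B′ s↝̸u lowest s-indist =
        glued-exchange ρ₀ y₀ my₀ strict both s-only r-only s-indist r-indist
        where
        s : Fin m
        s = B y₀
        y₀↝̸u : ¬ Walk y₀ u
        y₀↝̸u y₀↝u = proj₂ r-outer (r↝y₀ ◅◅ y₀↝u)
        s↝y₀ : Walk s y₀
        s↝y₀ = 𝔅.winner-walk y₀
        strict : Straight>Cross ρ₀ s r B B′ y₀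
        strict = cross-strict (glued-on-path y₀↝̸u s↝y₀) (glued-on-path y₀↝̸u r↝y₀) refl (B≢B′ ∘ sym)
                   (λ r≡s → B≢B′ (trans (sym r≡s) (sym (proj₁ (r-alike y₀) (sym r≡s)))))
        both : ∀ {y} → IsMatch y → ¬ Walk y u → Walk s y → Walk r y → Straight≥Cross ρ₀ s r B B′ y
        both {y} my y↝̸u s↝y r↝y = cross-mono (glued-on-path y↝̸u s↝y) (glued-on-path y↝̸u r↝y) s-alike (proj₁ (r-alike y))
          where
          s-alike : B′ y ≡ s → B y ≡ s
          s-alike B′y≡s with walk-comparable s↝y s↝y₀
          ... | inj₁ y↝y₀ = 𝔅.wins-below refl s↝y y↝y₀
          ... | inj₂ y₀↝y = ⊥-elim (B≢B′ (sym (𝔅′.wins-below B′y≡s s↝y₀ y₀↝y)))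
        s-only : ∀ {y} → IsMatch y → ¬ Walk y u → Walk s y → ¬ Walk r y → Straight≥Cross ρ₀ s r B B′ y
        s-only {y} my y↝̸u s↝y r↝̸y with walk-comparable s↝y s↝y₀
        ... | inj₁ y↝y₀ = cross-winner (trans (𝔅.wins-below refl s↝y y↝y₀) (sym (glued-on-path y↝̸u s↝y)))
        ... | inj₂ y₀↝y = ⊥-elim (r↝̸y (r↝y₀ ◅◅ y₀↝y))
        r-only : ∀ {y} → IsMatch y → ¬ Walk y u → ¬ Walk s y → Walk r y → Straight≥Cross ρ₀ s r B B′ y
        r-only {y} my y↝̸u s↝̸y r↝y with walk-comparable r↝y r↝y₀
        ... | inj₂ y₀↝y = ⊥-elim (s↝̸y (s↝y₀ ◅◅ y₀↝y))
        ... | inj₁ y↝y₀ = cross-mono (glued-off-path y↝̸u s↝̸y) (glued-on-path y↝̸u r↝y)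
                            (proj₂ (equalOrBothInner⇒outer-alike agreement (default-preserves-outer y y↝̸u)))
                            (proj₁ (r-alike y))
          where
          agreement : EqualOrBothInner (B y) (B′ y)
          agreement = lowest y r↝y y↝y₀ (λ { refl → s↝̸y s↝y₀ }) my

      disagreement-off-anchor-path : ∀ {y₀} → IsMatch y₀ → ¬ Walk y₀ u → ¬ Walk r y₀ → B y₀ ≢ B′ y₀ →
        ¬ Walk (B y₀) u → default y₀ ≢ B y₀ →
        (∀ y → Walk y₀ y → y ≢ y₀ → IsMatch y → EqualOrBothInner (B y) (B′ y)) →
        (∀ y → Walk r y → IsMatch y → EqualOrBothInner (B y) (B′ y)) →
        Indistinguishable B B′ (glued ρ₀ (B y₀)) → ⊥
      disagreement-off-anchor-path {y₀} my₀ y₀↝̸u r↝̸y₀ B≢B′ s↝̸u D≢s highest on-r-path s-indist =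
        glued-exchange ρ₀ y₀ my₀ strict both s-only r-only s-indist r-indist
        where
        s : Fin m
        s = B y₀
        s↝y₀ : Walk s y₀
        s↝y₀ = 𝔅.winner-walk y₀
        strict : Straight>Cross ρ₀ s r B B′ y₀
        strict = cross-strict (glued-on-path y₀↝̸u s↝y₀) (glued-off-path y₀↝̸u r↝̸y₀) refl (B≢B′ ∘ sym) D≢s
        both : ∀ {y} → IsMatch y → ¬ Walk y u → Walk s y → Walk r y → Straight≥Cross ρ₀ s r B B′ y
        both {y} my y↝̸u s↝y r↝y =
          cross-mono (glued-on-path y↝̸u s↝y) (glued-on-path y↝̸u r↝y)
            (proj₂ (equalOrBothInner⇒outer-alike (on-r-path y r↝y my) s↝̸u)) (proj₁ (r-alike y))
        s-only : ∀ {y} → IsMatch y → ¬ Walk y u → Walk s y → ¬ Walk r y → Straight≥Cross ρ₀ s r B B′ y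
        s-only {y} my y↝̸u s↝y r↝̸y with B y ≟ s
        ... | yes By≡s = cross-winner (trans By≡s (sym (glued-on-path y↝̸u s↝y)))
        ... | no By≢s with walk-comparable s↝y₀ s↝y
        ...   | inj₂ y↝y₀ = ⊥-elim (By≢s (𝔅.wins-below refl s↝y y↝y₀))
        ...   | inj₁ y₀↝y with y ≟ y₀
        ...     | yes refl = ⊥-elim (By≢s refl)
        ...     | no y≢y₀  = cross-mono (glued-on-path y↝̸u s↝y) (glued-off-path y↝̸u r↝̸y)
                               (proj₂ (equalOrBothInner⇒outer-alike agreement s↝̸u))
                               (proj₁ (equalOrBothInner⇒outer-alike agreement (default-preserves-outer y y↝̸u)))
          where
          agreement : EqualOrBothInner (B y) (B′ y)
          agreement = highest y y₀↝y y≢y₀ my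
        r-only : ∀ {y} → IsMatch y → ¬ Walk y u → ¬ Walk s y → Walk r y → Straight≥Cross ρ₀ s r B B′ y
        r-only {y} my y↝̸u s↝̸y r↝y =
          cross-mono (glued-off-path y↝̸u s↝̸y) (glued-on-path y↝̸u r↝y)
            (proj₂ (equalOrBothInner⇒outer-alike (on-r-path y r↝y my) (default-preserves-outer y y↝̸u)))
            (proj₁ (r-alike y))

  Disagreement : (B B′ : Fin m → Fin m) → Fin m → Set
  Disagreement B B′ y = IsMatch y × ¬ EqualOrBothInner (B y) (B′ y)

  disagreement? : ∀ B B′ y → Dec (Disagreement B B′ y)
  disagreement? B B′ y = match? y ×-dec ¬? (equalOrBothInner? (B y) (B′ y))

  agreement : ∀ B B′ {y} → IsMatch y → ¬ Disagreement B B′ y → EqualOrBothInner (B y) (B′ y)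
  agreement B B′ {y} my ¬d with equalOrBothInner? (B y) (B′ y)
  ... | yes e = e
  ... | no ¬e = ⊥-elim (¬d (my , ¬e))

  record Anchor (B B′ ρ₀ : Fin m → Fin m) (Paired : Fin m → Set) : Set where
    field
      player            : Fin m
      outer             : OuterPlayer player
      paired            : Paired player
      below-parent      : Walk player (parent u)
      indistinguishable : Indistinguishable B B′ (glued ρ₀ player)

  module OuterDecoding {B B′ : Fin m → Fin m} (isB : IsBracket B) (isB′ : IsBracket B′)
    (ρ₀ : Fin m → Fin m) (Paired : Fin m → Set) (paired-alike : ∀ a → Paired a → WinsAlike B B′ a)
    (singles : ∀ s → OuterPlayer s → ¬ Paired s → Indistinguishable B B′ (glued ρ₀ s))
    (anchor : Anchor B B′ ρ₀ Paired) where

    open Anchor anchor renaming (player to r)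
    module 𝔅  = BracketFacts isB
    module 𝔅′ = BracketFacts isB′

    r-alike : WinsAlike B B′ r
    r-alike = paired-alike r paired

    r-alike′ : WinsAlike B′ B r
    r-alike′ y = proj₂ (r-alike y) , proj₁ (r-alike y)

    module ⇉ = Between.Anchored isB isB′ ρ₀ r outer r-alike indistinguishable
    module ⇇ = Between.Anchored isB′ isB ρ₀ r outer r-alike′ (sym indistinguishable)

    winner-unpaired : ∀ {y} → B y ≢ B′ y → ¬ Paired (B y)
    winner-unpaired {y} B≢B′ p = B≢B′ (sym (proj₁ (paired-alike (B y) p y) refl))

    winner′-unpaired : ∀ {y} → B y ≢ B′ y → ¬ Paired (B′ y)
    winner′-unpaired {y} B≢B′ p = B≢B′ (proj₂ (paired-alike (B′ y) p y) refl)

    agreement-on-anchor-path : ∀ y → Walk r y → IsMatch y → EqualOrBothInner (B y) (B′ y)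
    agreement-on-anchor-path y r↝y my = agreement B B′ my (no-lowest ∘ lowest-on-walk _ (disagreement? B B′) r↝y)
      where
      no-lowest : ¬ Σ (Fin m) λ y₀ → Walk r y₀ × Walk y₀ y × Disagreement B B′ y₀ ×
                      (∀ y′ → Walk r y′ → Walk y′ y₀ → y′ ≢ y₀ → ¬ Disagreement B B′ y′)
      no-lowest (y₀ , r↝y₀ , _ , (my₀ , ¬agree) , lowest) = by-winners (walk? (B y₀) u) (walk? (B′ y₀) u)
        where
        lowest′ : ∀ y′ → Walk r y′ → Walk y′ y₀ → y′ ≢ y₀ → IsMatch y′ → EqualOrBothInner (B y′) (B′ y′)
        lowest′ y′ r↝y′ y′↝y₀ y′≢y₀ my′ = agreement B B′ my′ (lowest y′ r↝y′ y′↝y₀ y′≢y₀)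
        by-winners : Dec (Walk (B y₀) u) → Dec (Walk (B′ y₀) u) → ⊥
        by-winners (no s↝̸u) _ =
          ⇉.disagreement-on-anchor-path my₀ r↝y₀ (¬agree ∘ inj₁) s↝̸u lowest′
            (singles (B y₀) (𝔅.winner-isPlayer y₀ , s↝̸u) (winner-unpaired (¬agree ∘ inj₁)))
        by-winners (yes _) (no s′↝̸u) =
          ⇇.disagreement-on-anchor-path my₀ r↝y₀ (¬agree ∘ inj₁ ∘ sym) s′↝̸u
            (λ y′ r↝y′ y′↝y₀ y′≢y₀ my′ → equalOrBothInner-sym (lowest′ y′ r↝y′ y′↝y₀ y′≢y₀ my′))
            (sym (singles (B′ y₀) (𝔅′.winner-isPlayer y₀ , s′↝̸u) (winner′-unpaired (¬agree ∘ inj₁))))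
        by-winners (yes s↝u) (yes s′↝u) = ¬agree (inj₂ (s↝u , s′↝u))

    no-highest-disagreement : ∀ {y₀} → ¬ Walk y₀ u → Disagreement B B′ y₀ →
      (∀ y → Walk y₀ y → y ≢ y₀ → ¬ Disagreement B B′ y) → ⊥
    no-highest-disagreement {y₀} y₀↝̸u (my₀ , ¬agree) highest = by-default (default y₀ ≟ B y₀)
      where
      B≢B′ : B y₀ ≢ B′ y₀
      B≢B′ = ¬agree ∘ inj₁
      r↝̸y₀ : ¬ Walk r y₀
      r↝̸y₀ r↝y₀ = ¬agree (agreement-on-anchor-path y₀ r↝y₀ my₀)
      highest′ : ∀ y → Walk y₀ y → y ≢ y₀ → IsMatch y → EqualOrBothInner (B y) (B′ y)
      highest′ y y₀↝y y≢y₀ my = agreement B B′ my (highest y y₀↝y y≢y₀)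
      -- u is not below y₀, for then r, which reaches the parent of u, would reach y₀
      outer-below : ∀ {v} → Walk v y₀ → ¬ Walk v u
      outer-below v↝y₀ v↝u with walk-comparable v↝y₀ v↝u
      ... | inj₁ y₀↝u = y₀↝̸u y₀↝u
      ... | inj₂ u↝y₀ with u ≟ y₀
      ...   | yes refl = y₀↝̸u walk-refl
      ...   | no u≢y₀  = r↝̸y₀ (below-parent ◅◅ walk-via-parent u↝y₀ u≢y₀)
      by-default : Dec (default y₀ ≡ B y₀) → ⊥
      by-default (no D≢s) =
        ⇉.disagreement-off-anchor-path my₀ y₀↝̸u r↝̸y₀ B≢B′ (outer-below (𝔅.winner-walk y₀)) D≢s
          highest′ agreement-on-anchor-path
          (singles (B y₀) (𝔅.winner-isPlayer y₀ , outer-below (𝔅.winner-walk y₀)) (winner-unpaired B≢B′))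
      by-default (yes D≡s) =
        ⇇.disagreement-off-anchor-path my₀ y₀↝̸u r↝̸y₀ (B≢B′ ∘ sym) (outer-below (𝔅′.winner-walk y₀)) (B≢B′ ∘ trans (sym D≡s))
          (λ y y₀↝y y≢y₀ my → equalOrBothInner-sym (highest′ y y₀↝y y≢y₀ my))
          (λ y r↝y my → equalOrBothInner-sym (agreement-on-anchor-path y r↝y my))
          (sym (singles (B′ y₀) (𝔅′.winner-isPlayer y₀ , outer-below (𝔅′.winner-walk y₀)) (winner′-unpaired B≢B′)))

    outer-agreement : OuterAgreement B B′
    outer-agreement y my y↝̸u with highest-above y (Disagreement B B′) (disagreement? B B′)
    ... | inj₂ none = agreement B B′ my (none y walk-refl)
    ... | inj₁ (y₀ , y↝y₀ , d₀ , highest) = ⊥-elim (no-highest-disagreement (λ y₀↝u → y↝̸u (y↝y₀ ◅◅ y₀↝u)) d₀ highest)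

  outer-agreement : ∀ {B B′} → IsBracket B → IsBracket B′ → ∀ ρ₀ (Paired : Fin m → Set) →
    (∀ a → Paired a → WinsAlike B B′ a) →
    (∀ s → OuterPlayer s → ¬ Paired s → Indistinguishable B B′ (glued ρ₀ s)) →
    (u ≢ sink → Anchor B B′ ρ₀ Paired) → OuterAgreement B B′
  outer-agreement isB isB′ ρ₀ Paired paired-alike singles anchor y my y↝̸u with u ≟ sink
  ... | yes refl   = ⊥-elim (y↝̸u (walk-to-sink y))
  ... | no u≢sink  = OuterDecoding.outer-agreement isB isB′ ρ₀ Paired paired-alike singles (anchor u≢sink) y my y↝̸u

  inner-agreement : ∀ {B B′} → IsBracket B → IsBracket B′ → ∀ {du} (Rs : Fin du → Fin m → Fin m) →
    𝒯ᵤ.IsResolving R σ du Rs → OuterAgreement B B′ →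
    (∀ i → Σ (Fin m → Fin m) λ G → PreservesOuter G × Indistinguishable B B′ (glue (Rs i) G)) →
    ∀ v → Walk v u → B v ≡ B′ v
  inner-agreement {B} {B′} isB isB′ Rs (_ , resolves) agree cover v v↝u with B v ≟ B′ v
  ... | yes Bv≡B′v = Bv≡B′v
  ... | no Bv≢B′v with resolves B B′ (restrict-bracket isB) (restrict-bracket isB′) (v , below⇒sub-vertex v↝u , Bv≢B′v)
  ...   | i , s , s′ , sc , sc′ , s≢s′ =
    ⊥-elim (s≢s′ (trans (inner-score-unique sc) (trans inner-equal (sym (inner-score-unique sc′)))))
    where
    open Reals R using (_+_)
    G : Fin m → Fin m
    G = proj₁ (cover i)
    G-outer : PreservesOuter G
    G-outer = proj₁ (proj₂ (cover i))
    outer-equal : outer-score G B ≡ outer-score G B′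
    outer-equal = outer-score-cong λ y my y↝̸u →
      let (B⇒B′ , B′⇒B) = equalOrBothInner⇒outer-alike (agree y my y↝̸u) (G-outer y y↝̸u)
      in sym ∘ B⇒B′ ∘ sym , sym ∘ B′⇒B ∘ sym
    inner-equal : inner-score (Rs i) B ≡ inner-score (Rs i) B′
    inner-equal = RealOrder.+-cancelʳ R (outer-score G B) (begin
      inner-score (Rs i) B + outer-score G B    ≡⟨ sym (score-glue (Rs i) G B) ⟩
      score (glue (Rs i) G) B                   ≡⟨ proj₂ (proj₂ (cover i)) ⟩
      score (glue (Rs i) G) B′                  ≡⟨ score-glue (Rs i) G B′ ⟩
      inner-score (Rs i) B′ + outer-score G B′  ≡⟨ cong (inner-score (Rs i) B′ +_) (sym outer-equal) ⟩
      inner-score (Rs i) B′ + outer-score G B   ∎)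
      where open ≡-Reasoning

  brackets-equal : ∀ {B B′} → IsBracket B → IsBracket B′ → OuterAgreement B B′ →
                   (∀ v → Walk v u → B v ≡ B′ v) → ∀ v → B v ≡ B′ v
  brackets-equal {B} {B′} isB isB′ agree inner v with walk? v u
  ... | yes v↝u = inner v v↝u
  ... | no v↝̸u with match? v
  ...   | no ¬mv = trans (IsBracket.on-players isB v src) (sym (IsBracket.on-players isB′ v src))
    where
    src : IsSource v
    src = ¬match⇒source ¬mv
  ...   | yes mv with agree v mv v↝̸u
  ...     | inj₁ Bv≡B′v = Bv≡B′v
  ...     | inj₂ (Bv↝u , B′v↝u) = trans (sym (wins-u isB Bv↝u)) (trans (inner u walk-refl) (wins-u isB′ B′v↝u))
    where
    wins-u : ∀ {C} → IsBracket C → Walk (C v) u → C u ≡ C v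
    wins-u isC Cv↝u with walk-comparable (BracketFacts.winner-walk isC v) Cv↝u
    ... | inj₁ v↝u = ⊥-elim (v↝̸u v↝u)
    ... | inj₂ u↝v = BracketFacts.wins-below isC refl Cv↝u u↝v

  Favourable : Fin m → Set
  Favourable a = IsPlayer a × PreservesOuter (favouring a)

  outer⇒favourable : ∀ {a} → OuterPlayer a → Favourable a
  outer⇒favourable (pa , a↝̸u) = pa , champion-preserves-outer a↝̸u default-preserves-outer

  glued-bracket : ∀ {ρ a} → 𝒯ᵤ.IsBracket ρ → Favourable a → IsBracket (glued ρ a)
  glued-bracket isρ (pa , fav-outer) = glue-bracket isρ (champion-bracket pa default-bracket) fav-outer

  resolving-from-list : (Fam : List (Fin m → Fin m)) → (∀ {X} → X ∈ Fam → IsBracket X) →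
    (∀ {B B′} → IsBracket B → IsBracket B′ → All (Indistinguishable B B′) Fam → ∀ v → B v ≡ B′ v) →
    ∀ {K} → length Fam ℕ.≤ K → HasResolvingOfSize R σ K
  resolving-from-list Fam brackets decodes {K} |Fam|≤K = Bs , (λ i → nth-bracket Fam brackets (toℕ i)) , separates
    where
    open RealOrder R using (_≟ℝ_)
    nth : List (Fin m → Fin m) → ℕ → Fin m → Fin m
    nth []       _       = default
    nth (X ∷ _)  zero    = X
    nth (_ ∷ Xs) (suc j) = nth Xs j
    nth-bracket : ∀ Xs → (∀ {X} → X ∈ Xs → IsBracket X) → ∀ j → IsBracket (nth Xs j)
    nth-bracket []       _        j       = default-bracket
    nth-bracket (X ∷ Xs) brackets zero    = brackets (here refl)
    nth-bracket (X ∷ Xs) brackets (suc j) = nth-bracket Xs (brackets ∘ there) j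
    ∈⇒nth : ∀ {X} Xs → X ∈ Xs → Σ ℕ λ j → j ℕ.< length Xs × nth Xs j ≡ X
    ∈⇒nth (X ∷ Xs) (here refl) = zero , s≤s z≤n , refl
    ∈⇒nth (_ ∷ Xs) (there X∈Xs) with ∈⇒nth Xs X∈Xs
    ... | j , j< , nth≡X = suc j , s≤s j< , nth≡X
    Bs : Fin K → Fin m → Fin m
    Bs i = nth Fam (toℕ i)
    separates : ∀ B B′ → IsBracket B → IsBracket B′ → Distinct B B′ →
      Σ (Fin K) λ i → Σ (Reals.ℝ R) λ s → Σ (Reals.ℝ R) λ s′ → ScoreIs R σ (Bs i) B s × ScoreIs R σ (Bs i) B′ s′ × s ≢ s′
    separates B B′ isB isB′ (v , _ , Bv≢B′v) with All.all? (λ X → score X B ≟ℝ score X B′) Fam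
    ... | yes indist = ⊥-elim (Bv≢B′v (decodes isB isB′ indist v))
    ... | no ¬indist with find (¬All⇒Any¬ (λ X → score X B ≟ℝ score X B′) Fam ¬indist)
    ...   | X , X∈Fam , X-separates with ∈⇒nth Fam X∈Fam
    ...     | j , j<|Fam| , nth≡X =
      i , score (Bs i) B , score (Bs i) B′ , score-exists (Bs i) B , score-exists (Bs i) B′ ,
      subst (λ Y → score Y B ≢ score Y B′) (sym Bsᵢ≡X) X-separates
      where
      j<K : j ℕ.< K
      j<K = ℕ.<-≤-trans j<|Fam| |Fam|≤K
      i : Fin K
      i = fromℕ< j<K
      Bsᵢ≡X : Bs i ≡ X
      Bsᵢ≡X = trans (cong (nth Fam) (Fin.toℕ-fromℕ< j<K)) nth≡X

module OutsideMatches {m : ℕ} (A : Fin m → Fin m → Set) (isSET : Tournament.IsSET A) (u : Fin m)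
  (u∈U : Tournament.InU A u) (c : Fin m → ℕ) (card-c : ∀ x → Card (Tournament.InNbrOutside A u x) (c x)) where
  open Tournament A
  open IsSET isSET using (sink; acyclic)
  open InTree A isSET
  open AtVertex A isSET u

  Special : Fin m → Set
  Special x = MatchOutside u x × Walk x (parent u) × 2 ℕ.≤ c x

  two-outside⇒c≥2 : ∀ {x z₁ z₂} → InNbrOutside u x z₁ → InNbrOutside u x z₂ → z₁ ≢ z₂ → 2 ℕ.≤ c x
  two-outside⇒c≥2 {x} {z₁} {z₂} i₁ i₂ z₁≢z₂ with card-c x
  ... | zs , (_ , enum) , |zs|≡c = subst (2 ℕ.≤_) |zs|≡c (two (proj₂ (enum z₁) i₁) (proj₂ (enum z₂) i₂))
    where
    two : ∀ {zs : List (Fin m)} → z₁ ∈ zs → z₂ ∈ zs → 2 ℕ.≤ length zs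
    two (here refl) (here refl) = ⊥-elim (z₁≢z₂ refl)
    two (here _)    (there q)   = s≤s (∈.∈-length q)
    two (there p)   (here _)    = s≤s (∈.∈-length p)
    two (there p)   (there q)   = ℕ.m≤n⇒m≤1+n (two p q)

  module _ (u≢sink : u ≢ sink) where

    private
      u→parent : Arc u (parent u)
      u→parent = parent-arc u≢sink

      off-u-branch : ∀ {w z} → Arc w (parent u) → w ≢ u → Walk z w → ¬ Walk z u
      off-u-branch w→p w≢u z↝w z↝u = w≢u (in-neighbours-below⇒equal w→p u→parent z↝w z↝u)

    special-below-sibling-match : ∀ {w} → Arc w (parent u) → w ≢ u → IsMatch w → Σ (Fin m) Special
    special-below-sibling-match w→p w≢u mw with first-round-below mw
    ... | x , (mx , feeders) , x↝w with in-neighbour mx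
    ...   | z₁ , z₁→x with another-in-neighbour z₁→x
    ...     | z₂ , z₂→x , z₂≢z₁ =
      x , (mx , x∉𝒯ᵤ) , x↝w ◅◅ arc⇒walk w→p , two-outside⇒c≥2 (outside z₁→x) (outside z₂→x) (z₂≢z₁ ∘ sym)
      where
      outside : ∀ {z} → Arc z x → InNbrOutside u x z
      outside z→x = z→x , feeders _ z→x , λ (_ , z↝u) → off-u-branch w→p w≢u (arc⇒walk z→x ◅◅ x↝w) z↝u
      x∉𝒯ᵤ : ¬ 𝒯ᵤ.IsMatch x
      x∉𝒯ᵤ sx = off-u-branch w→p w≢u x↝w (proj₁ (sub-match⇒ sx))

    parent-special : ∀ {w₁ w₂} → Arc w₁ (parent u) → Arc w₂ (parent u) → w₁ ≢ u → w₂ ≢ u → w₁ ≢ w₂ →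
                     IsPlayer w₁ → IsPlayer w₂ → Special (parent u)
    parent-special w₁→p w₂→p w₁≢u w₂≢u w₁≢w₂ p₁ p₂ =
      (arc⇒match u→parent , λ sp → acyclic u→parent (proj₁ (sub-match⇒ sp))) , walk-refl ,
      two-outside⇒c≥2 (w₁→p , p₁ , λ (_ , w₁↝u) → off-u-branch w₁→p w₁≢u walk-refl w₁↝u)
                      (w₂→p , p₂ , λ (_ , w₂↝u) → off-u-branch w₂→p w₂≢u walk-refl w₂↝u) w₁≢w₂

    -- This is where u ∈ U is used: otherwise N⁻(parent u) = {w₁, u} for a player w₁.
    special-exists : Σ (Fin m) Special
    special-exists with Fin.any? (λ w → arc? w (parent u) ×-dec ¬? (w ≟ u) ×-dec match? w)
    ... | yes (w , w→p , w≢u , mw) = special-below-sibling-match w→p w≢u mw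
    ... | no no-match-sibling with another-in-neighbour u→parent
    ...   | w₁ , w₁→p , w₁≢u with Fin.any? (λ w → arc? w (parent u) ×-dec ¬? (w ≟ u) ×-dec ¬? (w ≟ w₁))
    ...     | yes (w₂ , w₂→p , w₂≢u , w₂≢w₁) =
      parent u , parent-special w₁→p w₂→p w₁≢u w₂≢u (w₂≢w₁ ∘ sym) (sibling-player w₁→p w₁≢u) (sibling-player w₂→p w₂≢u)
      where
      sibling-player : ∀ {w} → Arc w (parent u) → w ≢ u → IsPlayer w
      sibling-player w→p w≢u = ¬match⇒source (λ mw → no-match-sibling (_ , w→p , w≢u , mw))
    ...     | no no-third = ⊥-elim (u∈U (parent u , u→parent , w₁ , ¬match⇒source (λ mw → no-match-sibling (w₁ , w₁→p , w₁≢u , mw)) ,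
                                    λ w → only w , λ { (inj₁ refl) → w₁→p ; (inj₂ refl) → u→parent }))
      where
      only : ∀ w → Nin (parent u) w → w ≡ w₁ ⊎ w ≡ u
      only w w→p with w ≟ u | w ≟ w₁
      ... | yes w≡u | _        = inj₂ w≡u
      ... | no _    | yes w≡w₁ = inj₁ w≡w₁
      ... | no w≢u  | no w≢w₁  = ⊥-elim (no-third (w , w→p , w≢u , w≢w₁))

open import Data.Nat using (_≤_; _+_)

module Construction (R : Reals) {m : ℕ} (A : Fin m → Fin m → Set) (isSET : Tournament.IsSET A)
  (σ : Fin m → Reals.ℝ R) (σ-pos : Tournament.IsScoring A R σ) (u : Fin m) (u∈U : Tournament.InU A u)
  (c : Fin m → ℕ) (card-c : ∀ x → Card (Tournament.InNbrOutside A u x) (c x))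
  (S : ℕ) (sum-S : SumℕIs (Tournament.MatchOutside A u) (λ x → c x / 2) S)
  (du : ℕ) (dim-u : Tournament.Sub.DimIs A u R σ du) where

  open Tournament A
  open IsSET isSET using (sink)
  open InTree A isSET
  open AtVertex A isSET u
  open Scores A isSET u R σ σ-pos
  open Decoding A isSET u R σ σ-pos
  open OutsideMatches A isSET u u∈U c card-c
  open Pairing {Fin m} {Fin m}

  Rs : Fin du → Fin m → Fin m
  Rs = proj₁ (proj₁ dim-u)

  Rs-resolving : 𝒯ᵤ.IsResolving R σ du Rs
  Rs-resolving = proj₂ (proj₁ dim-u)

  -- Indices from du on (duels beyond the size of the resolving set) get the default bracket.
  inner : ℕ → Fin m → Fin m
  inner j with j ℕ.<? du
  ... | yes j<du = Rs (fromℕ< j<du)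
  ... | no _     = default

  inner-bracket : ∀ j → 𝒯ᵤ.IsBracket (inner j)
  inner-bracket j with j ℕ.<? du
  ... | yes j<du = proj₁ Rs-resolving (fromℕ< j<du)
  ... | no _     = restrict-bracket default-bracket

  inner-toℕ : ∀ i → inner (toℕ i) ≡ Rs i
  inner-toℕ i with toℕ i ℕ.<? du
  ... | yes i<du = cong Rs (Fin.fromℕ<-toℕ i i<du)
  ... | no i≮du  = ⊥-elim (i≮du (Fin.toℕ<n i))

  outsiders : Fin m → List (Fin m)
  outsiders x = proj₁ (card-c x)

  outsiders-enumerate : ∀ x → Enumerates (InNbrOutside u x) (outsiders x)
  outsiders-enumerate x = proj₁ (proj₂ (card-c x))

  length-outsiders : ∀ x → length (outsiders x) ≡ c x
  length-outsiders x = proj₂ (proj₂ (card-c x))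

  outside-matches : List (Fin m)
  outside-matches = proj₁ sum-S

  outside-matches-enumerate : Enumerates (MatchOutside u) outside-matches
  outside-matches-enumerate = proj₁ (proj₂ sum-S)

  pairs : List (Fin m × Fin m × Fin m)
  pairs = pairsOf outsiders outside-matches

  length-pairs : length pairs ≡ S
  length-pairs = begin
    length pairs                                                 ≡⟨ length-pairsOf outsiders outside-matches ⟩
    ℕ.sum (map (λ x → length (outsiders x) / 2) outside-matches) ≡⟨ cong ℕ.sum (List.map-cong (cong (_/ 2) ∘ length-outsiders) outside-matches) ⟩
    ℕ.sum (map (λ x → c x / 2) outside-matches)                  ≡⟨ sym (proj₂ (proj₂ sum-S)) ⟩
    S                                                            ∎
    where open ≡-Reasoning

  IsDuel : Fin m × Fin m × Fin m → Set
  IsDuel (a , b , x) = OuterPlayer a × OuterPlayer b × Arc a x × Arc b x × a ≢ b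

  private
    outsider : ∀ {x z} → z ∈ outsiders x → OuterPlayer z × Arc z x
    outsider {x} {z} z∈ with proj₁ (proj₂ (outsiders-enumerate x) z) z∈
    ... | z→x , pz , z∉Pᵤ = (pz , λ z↝u → z∉Pᵤ (pz , z↝u)) , z→x

  duel : ∀ {t} → t ∈ pairs → IsDuel t
  duel {a , b , x′} t∈ with ∈-pairsOf⁻ outsiders outside-matches t∈
  ... | x , _ , t∈x with ∈-pairUp⁻ (proj₁ (outsiders-enumerate x)) t∈x
  ...   | a∈ , b∈ , refl , a≢b = proj₁ (outsider a∈) , proj₁ (outsider b∈) , proj₂ (outsider a∈) , proj₂ (outsider b∈) , a≢b

  paired-outer : ∀ {a} → a ∈ members pairs → OuterPlayer a
  paired-outer a∈ with ∈-members⁻ pairs a∈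
  ... | t , t∈ , inj₁ refl = proj₁ (duel t∈)
  ... | t , t∈ , inj₂ refl = proj₁ (proj₂ (duel t∈))

  unique-members : Unique (members pairs)
  unique-members = unique-members-pairsOf outsiders outside-matches (proj₁ outside-matches-enumerate)
    (proj₁ ∘ outsiders-enumerate)
    (λ z∈x z∈x′ → arc-unique (proj₂ (outsider z∈x)) (proj₂ (outsider z∈x′)))

  duel-brackets : ℕ → List (Fin m × Fin m × Fin m) → List (Fin m → Fin m)
  duel-brackets t []                 = []
  duel-brackets t ((a , b , _) ∷ ps) = glued (inner t) a ∷ glued (inner t) b ∷ duel-brackets (suc t) ps

  length-duel-brackets : ∀ t ps → length (duel-brackets t ps) ≡ length (members ps)
  length-duel-brackets t []                 = refl
  length-duel-brackets t ((_ , _ , _) ∷ ps) = cong (suc ∘ suc) (length-duel-brackets (suc t) ps)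

  ∈-duel-brackets⁻ : ∀ {X} t ps → X ∈ duel-brackets t ps →
                     Σ ℕ λ j → Σ (Fin m) λ a → a ∈ members ps × X ≡ glued (inner j) a
  ∈-duel-brackets⁻ t ((a , b , _) ∷ ps) (here X≡)         = t , a , here refl , X≡
  ∈-duel-brackets⁻ t ((a , b , _) ∷ ps) (there (here X≡)) = t , b , there (here refl) , X≡
  ∈-duel-brackets⁻ t ((a , b , _) ∷ ps) (there (there p)) with ∈-duel-brackets⁻ (suc t) ps p
  ... | j , a′ , a′∈ , X≡ = j , a′ , there (there a′∈) , X≡

  ∈-duel-brackets⁺ : ∀ t ps {a b x} → (a , b , x) ∈ ps →
    Σ ℕ λ j → glued (inner j) a ∈ duel-brackets t ps × glued (inner j) b ∈ duel-brackets t ps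
  ∈-duel-brackets⁺ t (_ ∷ ps)           (here refl) = t , here refl , there (here refl)
  ∈-duel-brackets⁺ t ((_ , _ , _) ∷ ps) (there p) with ∈-duel-brackets⁺ (suc t) ps p
  ... | j , a-in , b-in = j , there (there a-in) , there (there b-in)

  duel-brackets-at : ∀ t ps p → p ℕ.< length ps →
    Σ (Fin m) λ a → a ∈ members ps × glued (inner (t + p)) a ∈ duel-brackets t ps
  duel-brackets-at t ps@((a , _ , _) ∷ _) zero _ =
    a , here refl , subst (λ k → glued (inner k) a ∈ duel-brackets t ps) (sym (ℕ.+-identityʳ t)) (here refl)
  duel-brackets-at t ((_ , _ , _) ∷ ps) (suc p) (s≤s p<) with duel-brackets-at (suc t) ps p p<
  ... | a , a∈ , X∈ = a , there (there a∈) , there (there (subst (λ k → glued (inner k) a ∈ duel-brackets (suc t) ps) (sym (ℕ.+-suc t p)) X∈))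

  Paired : Fin m → Set
  Paired a = a ∈ members pairs

  Single : Fin m → Set
  Single s = OuterPlayer s × ¬ Paired s

  single? : ∀ s → Dec (Single s)
  single? s = (source? s ×-dec ¬? (walk? s u)) ×-dec ¬? (s ∈? members pairs)
    where open import Data.List.Membership.DecPropositional (_≟_ {m}) using (_∈?_)

  singles : List (Fin m)
  singles = filter single? (allFin m)

  record AnchorChoice : Set where
    field
      index      : ℕ
      player     : Fin m
      favourable : Favourable player
      placed     : u ≢ sink → OuterPlayer player × Paired player × Walk player (parent u) ×
                              glued (inner index) player ∈ duel-brackets 0 pairs

  -- If u is the sink there are no outer players, and any player will do.
  anchor-choice : AnchorChoice
  anchor-choice with u ≟ sink
  ... | yes refl = record
    { index      = 0
    ; player     = proj₁ (player-below u)
    ; favourable = proj₁ (proj₂ (player-below u)) , λ y y↝̸u → ⊥-elim (y↝̸u (walk-to-sink y))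
    ; placed     = λ u≢u → ⊥-elim (u≢u refl)
    }
  ... | no u≢sink with special-exists u≢sink
  ...   | x , outside , x↝p , 2≤c
    with pairUp-nonempty x (outsiders x) (subst (2 ℕ.≤_) (sym (length-outsiders x)) 2≤c)
  ...     | a , b , ab∈ = record
    { index      = proj₁ (∈-duel-brackets⁺ 0 pairs t∈pairs)
    ; player     = a
    ; favourable = outer⇒favourable (proj₁ (duel t∈pairs))
    ; placed     = λ _ → proj₁ (duel t∈pairs) , ∈-members⁺ pairs t∈pairs ,
                         step (proj₁ (proj₂ (proj₂ (duel t∈pairs)))) x↝p , proj₁ (proj₂ (∈-duel-brackets⁺ 0 pairs t∈pairs))
    }
    where
    t∈pairs : (a , b , x) ∈ pairs
    t∈pairs = ∈-pairsOf⁺ outsiders outside-matches (proj₂ (proj₂ outside-matches-enumerate x) outside) ab∈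

  open AnchorChoice anchor-choice renaming (index to t₀; player to r₀)

  single-brackets extra-brackets family : List (Fin m → Fin m)
  single-brackets = map (glued (inner t₀)) singles
  extra-brackets  = applyUpTo (λ k → glued (inner (S + k)) r₀) (du ∸ S)
  family          = duel-brackets 0 pairs ++ single-brackets ++ extra-brackets

  private
    single : ∀ {s} → s ∈ singles → Single s
    single s∈ = proj₂ (∈.∈-filter⁻ single? {xs = allFin m} s∈)

  family-brackets : ∀ {X} → X ∈ family → IsBracket X
  family-brackets X∈ with ∈.∈-++⁻ (duel-brackets 0 pairs) X∈
  ... | inj₁ X∈duels with ∈-duel-brackets⁻ 0 pairs X∈duels
  ...   | j , a , a∈ , refl = glued-bracket (inner-bracket j) (outer⇒favourable (paired-outer a∈))
  family-brackets X∈ | inj₂ X∈rest with ∈.∈-++⁻ single-brackets X∈rest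
  ... | inj₁ X∈singles with ∈.∈-map⁻ (glued (inner t₀)) X∈singles
  ...   | s , s∈ , refl = glued-bracket (inner-bracket t₀) (outer⇒favourable (proj₁ (single s∈)))
  family-brackets X∈ | inj₂ X∈rest | inj₂ X∈extras with ∈.∈-applyUpTo⁻ (λ k → glued (inner (S + k)) r₀) X∈extras
  ... | k , _ , refl = glued-bracket (inner-bracket (S + k)) favourable

  family-length : ∀ {n pu} → Card IsPlayer n → Card (PlayersOf u) pu → length family ℕ.≤ (n ∸ pu) + (du ∸ S)
  family-length {n} {pu} card-n card-pu = begin
    length family
      ≡⟨ List.length-++ (duel-brackets 0 pairs) ⟩
    length (duel-brackets 0 pairs) + length (single-brackets ++ extra-brackets)
      ≡⟨ cong₂ _+_ (length-duel-brackets 0 pairs) (List.length-++ single-brackets) ⟩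
    length (members pairs) + (length single-brackets + length extra-brackets)
      ≡⟨ sym (ℕ.+-assoc (length (members pairs)) _ _) ⟩
    length (members pairs) + length single-brackets + length extra-brackets
      ≡⟨ cong₂ (λ k l → length (members pairs) + k + l) (List.length-map _ singles) (List.length-applyUpTo _ (du ∸ S)) ⟩
    length (members pairs) + length singles + (du ∸ S)
      ≡⟨ cong (_+ (du ∸ S)) (sym (List.length-++ (members pairs))) ⟩
    length (members pairs ++ singles) + (du ∸ S)
      ≤⟨ ℕ.+-monoˡ-≤ (du ∸ S) (length≤count outer? distinct all-outer) ⟩
    count outer? + (du ∸ S)
      ≡⟨ cong (_+ (du ∸ S)) (count-outer card-n card-pu) ⟩
    (n ∸ pu) + (du ∸ S)
      ∎
    where
    open ℕ.≤-Reasoning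
    open Counting
    distinct : Unique (members pairs ++ singles)
    distinct = Unique.++⁺ unique-members (Unique.filter⁺ single? (Unique.allFin⁺ m)) (λ (p , s) → proj₂ (single s) p)
    all-outer : ∀ {a} → a ∈ members pairs ++ singles → OuterPlayer a
    all-outer a∈ with ∈.∈-++⁻ (members pairs) a∈
    ... | inj₁ a∈pairs   = paired-outer a∈pairs
    ... | inj₂ a∈singles = proj₁ (single a∈singles)

  module _ {B B′ : Fin m → Fin m} (isB : IsBracket B) (isB′ : IsBracket B′)
           (indist : All (Indistinguishable B B′) family) where

    private
      duel-indist : ∀ {X} → X ∈ duel-brackets 0 pairs → Indistinguishable B B′ X
      duel-indist = All.lookup indist ∘ ∈.∈-++⁺ˡ

      single-indist : ∀ {X} → X ∈ single-brackets → Indistinguishable B B′ X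
      single-indist = All.lookup indist ∘ ∈.∈-++⁺ʳ (duel-brackets 0 pairs) ∘ ∈.∈-++⁺ˡ

      extra-indist : ∀ {X} → X ∈ extra-brackets → Indistinguishable B B′ X
      extra-indist = All.lookup indist ∘ ∈.∈-++⁺ʳ (duel-brackets 0 pairs) ∘ ∈.∈-++⁺ʳ single-brackets

    duellists-alike : ∀ {a b x} → (a , b , x) ∈ pairs → WinsAlike B B′ a × WinsAlike B B′ b
    duellists-alike {a} {b} t∈ with duel t∈ | ∈-duel-brackets⁺ 0 pairs t∈
    ... | oa , ob , a→x , b→x , a≢b | j , a-in , b-in =
      (λ y → ⇉ (inner j) oa ob a→x b→x a≢b eA eB y , ⇇ (inner j) oa ob a→x b→x a≢b (sym eA) (sym eB) y) ,
      (λ y → ⇉ (inner j) ob oa b→x a→x (a≢b ∘ sym) eB eA y , ⇇ (inner j) ob oa b→x a→x (a≢b ∘ sym) (sym eB) (sym eA) y)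
      where
      open Between isB isB′ using () renaming (pair-wins-alike to ⇉)
      open Between isB′ isB using () renaming (pair-wins-alike to ⇇)
      eA : Indistinguishable B B′ (glued (inner j) a)
      eA = duel-indist a-in
      eB : Indistinguishable B B′ (glued (inner j) b)
      eB = duel-indist b-in

    paired-alike : ∀ a → Paired a → WinsAlike B B′ a
    paired-alike a a∈ with ∈-members⁻ pairs a∈
    ... | t , t∈ , inj₁ refl = proj₁ (duellists-alike t∈)
    ... | t , t∈ , inj₂ refl = proj₂ (duellists-alike t∈)

    singles-indist : ∀ s → OuterPlayer s → ¬ Paired s → Indistinguishable B B′ (glued (inner t₀) s)
    singles-indist s os unpaired =
      single-indist (∈.∈-map⁺ (glued (inner t₀)) (∈.∈-filter⁺ single? (∈.∈-allFin s) (os , unpaired)))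

    anchor : u ≢ sink → Anchor B B′ (inner t₀) Paired
    anchor u≢sink with placed u≢sink
    ... | or₀ , paired , r₀↝p , r₀-in = record
      { player = r₀ ; outer = or₀ ; paired = paired ; below-parent = r₀↝p ; indistinguishable = duel-indist r₀-in }

    cover : ∀ i → Σ (Fin m → Fin m) λ G → PreservesOuter G × Indistinguishable B B′ (glue (Rs i) G)
    cover i with toℕ i ℕ.<? S
    ... | yes i<S with duel-brackets-at 0 pairs (toℕ i) (subst (toℕ i ℕ.<_) (sym length-pairs) i<S)
    ...   | a , a∈ , X∈ = favouring a , proj₂ (outer⇒favourable (paired-outer a∈)) ,
                          subst (λ ρ → Indistinguishable B B′ (glued ρ a)) (inner-toℕ i) (duel-indist X∈)
    cover i | no i≮S = favouring r₀ , proj₂ favourable ,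
      subst (λ ρ → Indistinguishable B B′ (glued ρ r₀)) (trans (cong inner S+k≡i) (inner-toℕ i))
        (extra-indist (∈.∈-applyUpTo⁺ (λ k → glued (inner (S + k)) r₀) k<))
      where
      S≤i : S ℕ.≤ toℕ i
      S≤i = ℕ.≮⇒≥ i≮S
      k : ℕ
      k = toℕ i ∸ S
      S+k≡i : S + k ≡ toℕ i
      S+k≡i = ℕ.m+[n∸m]≡n S≤i
      k< : k ℕ.< du ∸ S
      k< = ℕ.∸-monoˡ-< (Fin.toℕ<n i) S≤i

    family-decodes : ∀ v → B v ≡ B′ v
    family-decodes = brackets-equal isB isB′ outer-agrees
      (inner-agreement isB isB′ Rs Rs-resolving outer-agrees cover)
      where
      outer-agrees : OuterAgreement B B′
      outer-agrees = outer-agreement isB isB′ (inner t₀) Paired paired-alike singles-indist anchor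

theorem5p13 : (R : Reals) (m : ℕ) (A : Fin m → Fin m → Set) →
    Tournament.IsSET A →
    (n : ℕ) → Card (Tournament.IsPlayer A) n →
    (σ : Fin m → Reals.ℝ R) → Tournament.IsScoring A R σ →
    (u : Fin m) → Tournament.InU A u →
    (pu : ℕ) → Card (Tournament.PlayersOf A u) pu →
    (c : Fin m → ℕ) → (∀ x → Card (Tournament.InNbrOutside A u x) (c x)) →
    (S : ℕ) → SumℕIs (Tournament.MatchOutside A u) (λ x → c x / 2) S →
    (d : ℕ) → Tournament.DimIs A R σ d →
    (du : ℕ) → Tournament.Sub.DimIs A u R σ du →
    d ≤ (n ∸ pu) + (du ∸ S)
theorem5p13 R m A isSET n card-n σ σ-pos u u∈U pu card-pu c card-c S sum-S d dim du dim-u =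
  proj₂ dim ((n ∸ pu) + (du ∸ S))
    (resolving-from-list family family-brackets family-decodes (family-length card-n card-pu))
  where
  open Decoding A isSET u R σ σ-pos using (resolving-from-list)
  open Construction R A isSET σ σ-pos u u∈U c card-c S sum-S du dim-u
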